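{- Let $k\ge1$ and $m\ge 0$ be integers, let $r=m \bmod P_k$, and let $$E=\bigl|\{\,i:\ 1<i\le k,\ p_i\nmid r,\ \text{and }\bigl(2\mid r-(r\bmod p_i)+p_i\ \text{ or }\ p_i\mid r-1\bigr)\}\bigr|.$$ Then $$\varphi(P_k)\left\lfloor\frac{m}{P_k}\right\rfloor+r-\sum_{i=1}^{k}\left\lceil\frac{r}{p_i}\right\rceil+\sum_{i=2}^{k}\left\lfloor\frac{r}{2p_i}\right\rfloor+E+\sum_{i=2}^{k-1}\sum_{j=i+1}^{k}\varphi_{min}\!\left(\left\lfloor\frac{r}{p_ip_j}\right\rfloor,\,i-1\right)\le\varphi_{min}(m,k).$$
   Context: $p_i$ denotes the $i$-th prime ($p_1=2$) and $P_k=p_1\cdots p_k$; $\varphi(n)$ is Euler's totient function. For integers $b$, $n\ge0$, $t\ge1$, $\varphi(b,n,t)$ is the number of integers $a$ with $b<a\le b+n$ and $\gcd(a,P_t)=1$, and $\varphi_{min}(n,t)=\min_{b\in\mathbb{Z}}\varphi(b,n,t)$ (so $\varphi_{min}(0,t)=0$). -}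

module Defs where

open import Data.Nat using (ℕ; zero; suc; _+_; _*_; _∸_; _≤_; NonZero)
open import Data.Nat.Properties using (m*n≢0)
open import Data.Nat.DivMod using (_/_; _%_)
open import Data.Nat.GCD using (gcd)
open import Data.Nat.Primality using (prime?)
open import Data.Nat using (_!)
open import Data.Integer as ℤ using (ℤ; +_; ∣_∣)
open import Data.List using (List; length; filter; upTo; map)
open import Data.Nat.ListAction using (sum)
open import Data.Product using (Σ; _×_)
open import Relation.Nullary using (yes; no)
open import Relation.Binary.PropositionalEquality using (_≡_)
open import Data.Nat using (_≟_)

range : ℕ → ℕ → List ℕ
range a b = map (λ x → a + x) (upTo (suc b ∸ a))

sumRange : ℕ → ℕ → (ℕ → ℕ) → ℕ
sumRange a b f = sum (map f (range a b))

-- offset d of the first prime a + d with d < fuel (0 if none found)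
firstPrimeOffset : ℕ → ℕ → ℕ
firstPrimeOffset a zero = 0
firstPrimeOffset a (suc f) with prime? a
... | yes _ = 0
... | no _ = suc (firstPrimeOffset (suc a) f)

-- smallest prime > n (searched in (n, n + n!], which contains a prime
-- divisor of n! + 1 for n ≥ 1)
nextPrime : ℕ → ℕ
nextPrime n = suc (n + firstPrimeOffset (suc n) (n !))

-- primeAt i = p_{i+1}
primeAt : ℕ → ℕ
primeAt zero = 2
primeAt (suc i) = nextPrime (primeAt i)

-- p i = p_i  (1-indexed; p 1 = 2; p 0 is a junk value and never used)
p : ℕ → ℕ
p i = primeAt (i ∸ 1)

P : ℕ → ℕ
P zero = 1
P (suc k) = P k * p (suc k)

primeAt-nonZero : ∀ i → NonZero (primeAt i)
primeAt-nonZero zero = _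
primeAt-nonZero (suc i) = _

p-nonZero : ∀ i → NonZero (p i)
p-nonZero i = primeAt-nonZero (i ∸ 1)

P-nonZero : ∀ k → NonZero (P k)
P-nonZero zero = _
P-nonZero (suc k) = m*n≢0 (P k) (p (suc k)) {{P-nonZero k}} {{p-nonZero (suc k)}}

totient : ℕ → ℕ
totient n = length (filter (λ a → gcd a n ≟ 1) (range 1 n))

-- φ(b,n,t) = #{ a ∈ ℤ : b < a ≤ b + n, gcd(a, P_t) = 1 }
-- (gcd of an integer with a positive natural = gcd of its absolute value)
phiInt : ℤ → ℕ → ℕ → ℕ
phiInt b n t = length (filter (λ j → gcd ∣ b ℤ.+ + j ∣ (P t) ≟ 1) (range 1 n))

IsPhiMin : ℕ → ℕ → ℕ → Set
IsPhiMin n t v = Σ ℤ (λ b → phiInt b n t ≡ v) × ((b : ℤ) → v ≤ phiInt b n t)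

ceilDiv : ℕ → (d : ℕ) → .{{NonZero d}} → ℕ
ceilDiv a d = (a + (d ∸ 1)) / d

-- E = #{ i : 1 < i ≤ k, p_i ∤ r, (2 ∣ r - (r mod p_i) + p_i or p_i ∣ r - 1) }
-- with r - 1 computed in ℤ (so r = 0 gives -1).
Ecount : ℕ → ℕ → ℕ
Ecount k r = length (filter cond (range 2 k))
  where
  open import Data.Nat.Divisibility using (_∣_; _∣?_)
  open import Relation.Nullary.Decidable using (¬?; _×-dec_; _⊎-dec_)
  cond : (i : ℕ) → _
  cond i = ¬? (p i ∣? r) ×-dec ((2 ∣? (r ∸ (_%_ r (p i) {{p-nonZero i}}) + p i)) ⊎-dec (p i ∣? ∣ + r ℤ.- + 1 ∣))

-- left-hand side of Theorem 4.4, given a function fmin playing φ_min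
lhs : (ℕ → ℕ → ℕ) → ℕ → ℕ → ℤ
lhs fmin k m =
  + (totient (P k) * (_/_ m (P k) {{P-nonZero k}})) ℤ.+ + r
  ℤ.- + sumRange 1 k (λ i → ceilDiv r (p i) {{p-nonZero i}})
  ℤ.+ + sumRange 2 k (λ i → _/_ r (2 * p i) {{m*n≢0 2 (p i) {{_}} {{p-nonZero i}}}})
  ℤ.+ + Ecount k r
  ℤ.+ + sumRange 2 (k ∸ 1) (λ i → sumRange (suc i) k (λ j →
          fmin (_/_ r (p i * p j) {{m*n≢0 (p i) (p j) {{p-nonZero i}} {{p-nonZero j}}}}) (i ∸ 1)))
  where
  r = _%_ m (P k) {{P-nonZero k}}

-- Write m = q Pₖ + r. Whether x survives the sieve by p₁, …, pₖ depends only on x mod Pₖ and is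
-- invariant under x ↦ −x, so every window of length m contains φ(Pₖ) q survivors plus those of a
-- window (c, c + r] of naturals, and it suffices to bound the latter from below.
-- Sieve that window one prime at a time. Sieving by 2 leaves at least r − ⌈r/2⌉. Sieving by pⱼ, j ≥ 2,
-- removes the odd multiples of pⱼ (at most ⌈r/pⱼ⌉ − ⌊r/(2pⱼ)⌋ of them, one fewer when the condition
-- defining E holds) except those whose least prime factor is some pᵢ with 2 ≤ i < j: these are the
-- multiples of pᵢpⱼ surviving p₁, …, pᵢ₋₁, and there are at least φ_min(⌊r/(pᵢpⱼ)⌋, i − 1) of them.
-- The one configuration where the saving from E fails (both ends of the window are odd multiples
-- of pⱼ) is paid for by a unit of slack left by the first step.

module Submission where

open import Defs
open import Data.Bool.Base using (Bool; true; false; _∧_; not)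
open import Data.Bool.Properties using (∧-comm; ∧-identityʳ; ∧-zeroʳ; not-involutive; not-¬; ¬-not)
open import Data.Empty using (⊥; ⊥-elim)
open import Data.Integer.Base as ℤ using (-[1+_]; ∣_∣)
import Data.Integer.Properties as ℤ
import Data.Integer.Tactic.RingSolver as ℤ
open import Data.List.Base using ([]; _∷_; map; filter; length; applyUpTo)
open import Data.Nat.ListAction using (sum)
open import Data.List.Relation.Unary.All using (_∷_)
open import Data.Nat.Base
open import Data.Nat.Properties
open import Algebra.Properties.CommutativeSemigroup +-commutativeSemigroup using () renaming (interchange to +-interchange)
open import Data.Nat.DivMod
open import Data.Nat.Tactic.RingSolver using (solve-∀)
open import Data.Nat.Divisibility
open import Data.Nat.Primality
open import Data.Nat.Coprimality using (Coprime; coprime-divisor; coprime⇒gcd≡1; gcd≡1⇒coprime)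
open import Data.Nat.GCD using (gcd)
open import Data.Nat.Primality.Factorisation using (factorise)
open import Data.Product.Base using (∃-syntax; _×_; _,_; proj₁; proj₂; uncurry)
open import Data.Sum.Base using (_⊎_; inj₁; inj₂; [_,_]′)
open import Function.Base using (id; _∘_; _∘′_)
open import Function.Bundles using (_⇔_; mk⇔; Equivalence)
open import Relation.Binary.Definitions using (tri<; tri≈; tri>)
open import Relation.Binary.PropositionalEquality
open import Relation.Nullary using (¬_; Dec; yes; no; does)
open import Relation.Unary using (Decidable)
open import Relation.Nullary.Decidable using (dec-true; dec-false; does-⇔; map′; _×-dec_; _⊎-dec_; ¬?)

-- The primes pᵢ

prime-divisor : ∀ {n} → 2 ≤ n → ∃[ q ] Prime q × q ∣ n
prime-divisor {n} 2≤n with factorise n {{>-nonZero (≤-trans (s≤s z≤n) 2≤n)}}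
... | record { factors = [] ; isFactorisation = n≡1 } = ⊥-elim (<⇒≢ 2≤n (sym n≡1))
... | record { factors = q ∷ _ ; isFactorisation = refl ; factorsPrime = q-prime ∷ _ } =
  q , q-prime , m∣m*n _

firstPrimeOffset-prime : ∀ a f d → d < f → Prime (a + d) → Prime (a + firstPrimeOffset a f)
firstPrimeOffset-prime a (suc f) d d<f a+d-prime with prime? a
... | yes a-prime = subst Prime (sym (+-identityʳ a)) a-prime
firstPrimeOffset-prime a (suc f) zero _ a+0-prime | no ¬a-prime =
  ⊥-elim (¬a-prime (subst Prime (+-identityʳ a) a+0-prime))
firstPrimeOffset-prime a (suc f) (suc d) (s≤s d<f) a+d-prime | no _ =
  subst Prime (sym (+-suc a _))
    (firstPrimeOffset-prime (suc a) f d d<f (subst Prime (+-suc a d) a+d-prime))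

n∣n! : ∀ n → 1 ≤ n → n ∣ n !
n∣n! (suc n) _ = m∣m*n (n !)

-- A prime factor q of n! + 1 cannot be ≤ n (it would divide n!), so n < q ≤ n + n!.
nextPrime-prime : ∀ n → 1 ≤ n → Prime (nextPrime n)
nextPrime-prime n 1≤n with prime-divisor {suc (n !)} (s≤s (1≤n! n))
... | q , q-prime , q∣1+n! =
  firstPrimeOffset-prime (suc n) (n !) (q ∸ suc n) offset<n! (subst Prime (sym (m+[n∸m]≡n n<q)) q-prime)
  where
  2≤q : 2 ≤ q
  2≤q = nonTrivial⇒n>1 q {{prime⇒nonTrivial q-prime}}
  n<q : n < q
  n<q = ≰⇒> λ q≤n → <⇒≢ 2≤q (sym (∣1⇒≡1 (∣m+n∣m⇒∣n (subst (q ∣_) (+-comm 1 (n !)) q∣1+n!)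
                                                    (∣-trans (n∣n! q (<⇒≤ 2≤q)) (m≤n⇒m!∣n! q≤n)))))
  offset<n! : q ∸ suc n < n !
  offset<n! = +-cancelˡ-< (suc n) _ _ (begin-strict
    suc n + (q ∸ suc n) ≡⟨ m+[n∸m]≡n n<q ⟩
    q                   ≤⟨ ∣⇒≤ q∣1+n! ⟩
    suc (n !)           ≤⟨ +-monoˡ-≤ (n !) 1≤n ⟩
    n + n !             <⟨ n<1+n _ ⟩
    suc n + n !         ∎)
    where open ≤-Reasoning

primeAt-prime : ∀ i → Prime (primeAt i)
primeAt-prime zero    = prime[2]
primeAt-prime (suc i) = nextPrime-prime (primeAt i) (<⇒≤ (nonTrivial⇒n>1 _ {{prime⇒nonTrivial (primeAt-prime i)}}))

primeAt-<-mono : ∀ {i j} → i < j → primeAt i < primeAt j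
primeAt-<-mono {i} {suc j} (s≤s i≤j) with m≤n⇒m<n∨m≡n i≤j
... | inj₁ i<j  = <-trans (primeAt-<-mono i<j) (s≤s (m≤m+n _ _))
... | inj₂ refl = s≤s (m≤m+n _ _)

p-prime : ∀ i → Prime (p i)
p-prime i = primeAt-prime (i ∸ 1)

p≥2 : ∀ i → 2 ≤ p i
p≥2 i = nonTrivial⇒n>1 _ {{prime⇒nonTrivial (p-prime i)}}

p-injective : ∀ {i j} → 1 ≤ i → 1 ≤ j → p i ≡ p j → i ≡ j
p-injective {suc i} {suc j} _ _ pᵢ≡pⱼ with <-cmp i j
... | tri< i<j _ _ = ⊥-elim (<⇒≢ (primeAt-<-mono i<j) pᵢ≡pⱼ)
... | tri≈ _ refl _ = refl
... | tri> _ _ j<i = ⊥-elim (<⇒≢ (primeAt-<-mono j<i) (sym pᵢ≡pⱼ))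

prime∤prime : ∀ {a b} → Prime a → Prime b → a ≢ b → ¬ a ∣ b
prime∤prime a-prime b-prime a≢b a∣b with prime⇒irreducible b-prime a∣b
... | inj₁ a≡1 = nonTrivial⇒≢1 {{prime⇒nonTrivial a-prime}} a≡1
... | inj₂ a≡b = a≢b a≡b

p∤p : ∀ {i j} → 1 ≤ i → 1 ≤ j → i ≢ j → ¬ p i ∣ p j
p∤p {i} {j} 1≤i 1≤j i≢j = prime∤prime (p-prime i) (p-prime j) (i≢j ∘′ p-injective 1≤i 1≤j)

p-odd : ∀ i → 2 ≤ i → ¬ 2 ∣ p i
p-odd (suc zero) (s≤s ())
p-odd (suc (suc i)) _  = prime∤prime prime[2] (p-prime (2 + i)) (<⇒≢ (primeAt-<-mono {0} {suc i} (s≤s z≤n)))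

p∣P : ∀ {i t} → 1 ≤ i → i ≤ t → p i ∣ P t
p∣P {suc i} {zero} _ ()
p∣P {i} {suc t} 1≤i i≤1+t with m≤n⇒m<n∨m≡n i≤1+t
... | inj₁ (s≤s i≤t) = ∣-trans (p∣P 1≤i i≤t) (m∣m*n (p (suc t)))
... | inj₂ refl      = n∣m*n (P t)

p*p∣ : ∀ {i j x} → 1 ≤ i → 1 ≤ j → i ≢ j → p i ∣ x → p j ∣ x → p i * p j ∣ x
p*p∣ {i} {j} 1≤i 1≤j i≢j (divides a refl) pⱼ∣a*pᵢ with euclidsLemma a (p i) (p-prime j) pⱼ∣a*pᵢ
... | inj₁ (divides b refl) = divides b (trans (*-assoc b (p j) (p i)) (cong (b *_) (*-comm (p j) (p i))))
... | inj₂ pⱼ∣pᵢ            = ⊥-elim (p∤p 1≤j 1≤i (i≢j ∘′ sym) pⱼ∣pᵢ)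

-- Sieving by p₁, …, pₜ

dec-true⁻¹ : ∀ {A : Set} (a? : Dec A) → does a? ≡ true → A
dec-true⁻¹ (yes a) _ = a

∧≡true⁻ : ∀ {a b} → a ∧ b ≡ true → a ≡ true × b ≡ true
∧≡true⁻ {true} b≡true = refl , b≡true

infix 6.5 _∣ᵇ_

_∣ᵇ_ : ℕ → ℕ → Bool
d ∣ᵇ x = does (d ∣? x)

coprime-* : ∀ {x a b} → Coprime x a → Coprime x b → Coprime x (a * b)
coprime-* {x} {a} ca cb (d∣x , d∣ab) = cb (d∣x , coprime-divisor d⊥a d∣ab)
  where
  d⊥a : Coprime _ a
  d⊥a (e∣d , e∣a) = ca (∣-trans e∣d d∣x , e∣a)

coprime-*⁻ˡ : ∀ {x a b} → Coprime x (a * b) → Coprime x a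
coprime-*⁻ˡ c (d∣x , d∣a) = c (d∣x , ∣-trans d∣a (m∣m*n _))

coprime-*⁻ʳ : ∀ {x a b} → Coprime x (a * b) → Coprime x b
coprime-*⁻ʳ {a = a} c (d∣x , d∣b) = c (d∣x , ∣-trans d∣b (n∣m*n a))

coprime-prime⇔∤ : ∀ {x q} → Prime q → Coprime x q ⇔ (¬ q ∣ x)
coprime-prime⇔∤ {x} {q} q-prime = mk⇔
  (λ c q∣x → nonTrivial⇒≢1 {{prime⇒nonTrivial q-prime}} (c (q∣x , ∣-refl)))
  (λ q∤x {d} (d∣x , d∣q) → [ id , (λ { refl → ⊥-elim (q∤x d∣x) }) ]′ (prime⇒irreducible q-prime d∣q))

coprime-P? : ∀ t x → Dec (Coprime x (P t))
coprime-P? zero    x = yes λ (_ , d∣1) → ∣1⇒≡1 d∣1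
coprime-P? (suc t) x = map′ join split (coprime-P? t x ×-dec ¬? (p (suc t) ∣? x))
  where
  p⊥⇔∤ = coprime-prime⇔∤ {x} (p-prime (suc t))
  join : Coprime x (P t) × ¬ p (suc t) ∣ x → Coprime x (P (suc t))
  join (c , p∤x) = coprime-* c (Equivalence.from p⊥⇔∤ p∤x)
  split : Coprime x (P (suc t)) → Coprime x (P t) × ¬ p (suc t) ∣ x
  split c = coprime-*⁻ˡ c , Equivalence.to p⊥⇔∤ (coprime-*⁻ʳ {a = P t} c)

-- survives (suc t) x unfolds definitionally to  survives t x ∧ not (p (suc t) ∣ᵇ x).
survives : ℕ → ℕ → Bool
survives t x = does (coprime-P? t x)

gcd≟1≡survives : ∀ t x → does (gcd x (P t) ≟ 1) ≡ survives t x
gcd≟1≡survives t x = does-⇔ (mk⇔ gcd≡1⇒coprime coprime⇒gcd≡1) (gcd x (P t) ≟ 1) (coprime-P? t x)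

survives-cong : ∀ t {u v} → (∀ i → 1 ≤ i → i ≤ t → (p i ∣ u) ⇔ (p i ∣ v)) → survives t u ≡ survives t v
survives-cong zero    _ = refl
survives-cong (suc t) {u} {v} same = cong₂ _∧_
  (survives-cong t (λ i 1≤i i≤t → same i 1≤i (m≤n⇒m≤1+n i≤t)))
  (cong not (does-⇔ (same (suc t) (s≤s z≤n) ≤-refl) (p (suc t) ∣? u) (p (suc t) ∣? v)))

survives-*p : ∀ t a y → t < a → survives t (y * p a) ≡ survives t y
survives-*p t a y t<a = survives-cong t λ i 1≤i i≤t → mk⇔
  (λ pᵢ∣y*pₐ → [ id , (λ pᵢ∣pₐ → ⊥-elim (p∤p 1≤i (≤-trans 1≤i (≤-trans i≤t (<⇒≤ t<a))) (<⇒≢ (≤-<-trans i≤t t<a)) pᵢ∣pₐ)) ]′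
                 (euclidsLemma y (p a) (p-prime i) pᵢ∣y*pₐ))
  (λ pᵢ∣y → ∣-trans pᵢ∣y (m∣m*n (p a)))

survives-/p : ∀ t a x → t < a → (pₐ∣x : p a ∣ x) → survives t (_/_ x (p a) {{p-nonZero a}}) ≡ survives t x
survives-/p t a x t<a pₐ∣x =
  trans (sym (survives-*p t a _ t<a)) (cong (survives t) (m/n*n≡m {{p-nonZero a}} pₐ∣x))

survives-/pp : ∀ t a b x → t < a → t < b → (d∣x : p a * p b ∣ x) →
               survives t (_/_ x (p a * p b) {{m*n≢0 (p a) (p b) {{p-nonZero a}} {{p-nonZero b}}}}) ≡ survives t x
survives-/pp t a b x t<a t<b d∣x = begin
  survives t (x / d)               ≡⟨ sym (survives-*p t a _ t<a) ⟩
  survives t (x / d * p a)         ≡⟨ sym (survives-*p t b _ t<b) ⟩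
  survives t (x / d * p a * p b)   ≡⟨ cong (survives t) (*-assoc (x / d) (p a) (p b)) ⟩
  survives t (x / d * (p a * p b)) ≡⟨ cong (survives t) (m/n*n≡m {{nz}} d∣x) ⟩
  survives t x                     ∎
  where
  open ≡-Reasoning
  d = p a * p b
  instance nz = m*n≢0 (p a) (p b) {{p-nonZero a}} {{p-nonZero b}}

survives-complement : ∀ t {M} u v → P t ∣ M → u + v ≡ M → survives t u ≡ survives t v
survives-complement t {M} u v P∣M u+v≡M = survives-cong t λ i 1≤i i≤t →
  let pᵢ∣u+v = subst (p i ∣_) (sym u+v≡M) (∣-trans (p∣P 1≤i i≤t) P∣M)
  in mk⇔ (∣m+n∣m⇒∣n pᵢ∣u+v) (∣m+n∣m⇒∣n (subst (p i ∣_) (+-comm u v) pᵢ∣u+v))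

survives-periodic : ∀ t {M} x → P t ∣ M → survives t (M + x) ≡ survives t x
survives-periodic t {M} x P∣M = survives-cong t λ i 1≤i i≤t →
  let pᵢ∣M = ∣-trans (p∣P 1≤i i≤t) P∣M in mk⇔ (λ pᵢ∣M+x → ∣m+n∣m⇒∣n pᵢ∣M+x pᵢ∣M) (∣m∣n⇒∣m+n pᵢ∣M)

-- Sums and counts over windows

𝟙 : Bool → ℕ
𝟙 true  = 1
𝟙 false = 0

𝟙≤1 : ∀ b → 𝟙 b ≤ 1
𝟙≤1 true  = ≤-refl
𝟙≤1 false = z≤n

𝟙-mono : ∀ {a b} → (a ≡ true → b ≡ true) → 𝟙 a ≤ 𝟙 b
𝟙-mono {false} _   = z≤n
𝟙-mono {true}  a⇒b rewrite a⇒b refl = ≤-refl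

𝟙-not : ∀ b → 𝟙 b + 𝟙 (not b) ≡ 1
𝟙-not true  = refl
𝟙-not false = refl

𝟙-split : ∀ a b → 𝟙 a ≡ 𝟙 (a ∧ not b) + 𝟙 (a ∧ b)
𝟙-split true  true  = refl
𝟙-split true  false = refl
𝟙-split false _     = refl

-- sumOver w c n = Σ { w x ∣ c < x ≤ c + n }
sumOver : (ℕ → ℕ) → ℕ → ℕ → ℕ
sumOver w c zero    = 0
sumOver w c (suc n) = w (suc c) + sumOver w (suc c) n

count : (ℕ → Bool) → ℕ → ℕ → ℕ
count f = sumOver (λ x → 𝟙 (f x))

sumOver-+ : ∀ w c m n → sumOver w c (m + n) ≡ sumOver w c m + sumOver w (c + m) n
sumOver-+ w c zero    n = cong (λ c′ → sumOver w c′ n) (sym (+-identityʳ c))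
sumOver-+ w c (suc m) n = begin
  w (suc c) + sumOver w (suc c) (m + n)                             ≡⟨ cong (w (suc c) +_) (sumOver-+ w (suc c) m n) ⟩
  w (suc c) + (sumOver w (suc c) m + sumOver w (suc c + m) n)       ≡⟨ +-assoc (w (suc c)) _ _ ⟨
  w (suc c) + sumOver w (suc c) m + sumOver w (suc c + m) n         ≡⟨ cong (λ c′ → w (suc c) + sumOver w (suc c) m + sumOver w c′ n) (+-suc c m) ⟨
  w (suc c) + sumOver w (suc c) m + sumOver w (c + suc m) n         ∎
  where open ≡-Reasoning

sumOver-suc : ∀ w c n → sumOver w c (suc n) ≡ sumOver w c n + w (c + suc n)
sumOver-suc w c n = begin
  sumOver w c (suc n)                      ≡⟨ cong (sumOver w c) (+-comm 1 n) ⟩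
  sumOver w c (n + 1)                      ≡⟨ sumOver-+ w c n 1 ⟩
  sumOver w c n + (w (suc (c + n)) + 0)    ≡⟨ cong (λ x → sumOver w c n + x) (+-identityʳ _) ⟩
  sumOver w c n + w (suc (c + n))          ≡⟨ cong (λ x → sumOver w c n + w x) (+-suc c n) ⟨
  sumOver w c n + w (c + suc n)            ∎
  where open ≡-Reasoning

sumOver-cong : ∀ {w v} → (∀ x → w x ≡ v x) → ∀ c n → sumOver w c n ≡ sumOver v c n
sumOver-cong w≡v c zero    = refl
sumOver-cong w≡v c (suc n) = cong₂ _+_ (w≡v (suc c)) (sumOver-cong w≡v (suc c) n)

sumOver-monoʳ-≤ : ∀ w c {m n} → m ≤ n → sumOver w c m ≤ sumOver w c n
sumOver-monoʳ-≤ w c {m} {n} m≤n = begin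
  sumOver w c m                             ≤⟨ m≤m+n _ _ ⟩
  sumOver w c m + sumOver w (c + m) (n ∸ m) ≡⟨ sumOver-+ w c m (n ∸ m) ⟨
  sumOver w c (m + (n ∸ m))                 ≡⟨ cong (sumOver w c) (m+[n∸m]≡n m≤n) ⟩
  sumOver w c n                             ∎
  where open ≤-Reasoning

sumOver-distrib-+ : ∀ w v c n → sumOver (λ x → w x + v x) c n ≡ sumOver w c n + sumOver v c n
sumOver-distrib-+ w v c zero    = refl
sumOver-distrib-+ w v c (suc n) = trans (cong (w (suc c) + v (suc c) +_) (sumOver-distrib-+ w v (suc c) n))
                                        (+-interchange (w (suc c)) (v (suc c)) _ _)

sumOver-const : ∀ k c n → sumOver (λ _ → k) c n ≡ n * k
sumOver-const k c zero    = refl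
sumOver-const k c (suc n) = cong (k +_) (sumOver-const k (suc c) n)

sumOver-shift : ∀ k w → (∀ x → w (k + x) ≡ w x) → ∀ c n → sumOver w (k + c) n ≡ sumOver w c n
sumOver-shift k w periodic c zero    = refl
sumOver-shift k w periodic c (suc n) = cong₂ _+_
  (trans (cong w (sym (+-suc k c))) (periodic (suc c)))
  (trans (cong (λ c′ → sumOver w c′ n) (sym (+-suc k c))) (sumOver-shift k w periodic (suc c) n))

sumOver-period-start : ∀ w M → (∀ x → w (M + x) ≡ w x) → ∀ c → sumOver w c M ≡ sumOver w 0 M
sumOver-period-start w M periodic zero    = refl
sumOver-period-start w M periodic (suc c) = trans step (sumOver-period-start w M periodic c)
  where
  step : sumOver w (suc c) M ≡ sumOver w c M
  step = +-cancelˡ-≡ (w (suc c)) _ _ (begin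
    w (suc c) + sumOver w (suc c) M ≡⟨ sumOver-suc w c M ⟩
    sumOver w c M + w (c + suc M)   ≡⟨ cong (λ x → sumOver w c M + w x) (trans (+-comm c (suc M)) (sym (+-suc M c))) ⟩
    sumOver w c M + w (M + suc c)   ≡⟨ cong (sumOver w c M +_) (periodic (suc c)) ⟩
    sumOver w c M + w (suc c)       ≡⟨ +-comm (sumOver w c M) _ ⟩
    w (suc c) + sumOver w c M       ∎)
    where open ≡-Reasoning

sumOver-periodic : ∀ w M → (∀ x → w (M + x) ≡ w x) → ∀ n c → sumOver w c (n * M) ≡ n * sumOver w 0 M
sumOver-periodic w M periodic zero    c = refl
sumOver-periodic w M periodic (suc n) c = trans (sumOver-+ w c M (n * M))
  (cong₂ _+_ (sumOver-period-start w M periodic c) (sumOver-periodic w M periodic n (c + M)))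

sumBelow : (ℕ → ℕ) → ℕ → ℕ
sumBelow h zero    = 0
sumBelow h (suc n) = h 0 + sumBelow (h ∘ suc) n

sumBelow-suc : ∀ h n → sumBelow h (suc n) ≡ sumBelow h n + h n
sumBelow-suc h zero    = +-comm (h 0) 0
sumBelow-suc h (suc n) = trans (cong (h 0 +_) (sumBelow-suc (h ∘ suc) n)) (sym (+-assoc (h 0) _ _))

sumBelow-cong : ∀ {h g} n → (∀ x → x < n → h x ≡ g x) → sumBelow h n ≡ sumBelow g n
sumBelow-cong zero    _   = refl
sumBelow-cong (suc n) h≡g = cong₂ _+_ (h≡g 0 z<s) (sumBelow-cong n (λ x x<n → h≡g (suc x) (s<s x<n)))

sumBelow-mono-≤ : ∀ {h g} n → (∀ x → x < n → h x ≤ g x) → sumBelow h n ≤ sumBelow g n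
sumBelow-mono-≤ zero    _   = z≤n
sumBelow-mono-≤ (suc n) h≤g = +-mono-≤ (h≤g 0 z<s) (sumBelow-mono-≤ n (λ x x<n → h≤g (suc x) (s<s x<n)))

sumBelow-distrib-+ : ∀ h g n → sumBelow (λ x → h x + g x) n ≡ sumBelow h n + sumBelow g n
sumBelow-distrib-+ h g zero    = refl
sumBelow-distrib-+ h g (suc n) = trans (cong (h 0 + g 0 +_) (sumBelow-distrib-+ (h ∘ suc) (g ∘ suc) n))
                                       (+-interchange (h 0) (g 0) _ _)

sumBelow-sumOver : ∀ w c n → sumBelow (λ x → w (c + suc x)) n ≡ sumOver w c n
sumBelow-sumOver w c zero    = refl
sumBelow-sumOver w c (suc n) = cong₂ _+_ (cong w (+-comm c 1))
  (trans (sumBelow-cong n (λ x _ → cong w (+-suc c (suc x)))) (sumBelow-sumOver w (suc c) n))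

sumBelow-sumOver-comm : ∀ (W : ℕ → ℕ → ℕ) c n k →
                        sumBelow (λ i → sumOver (W i) c n) k ≡ sumOver (λ x → sumBelow (λ i → W i x) k) c n
sumBelow-sumOver-comm W c n zero    = sym (trans (sumOver-const 0 c n) (*-zeroʳ n))
sumBelow-sumOver-comm W c n (suc k) = begin
  sumOver (W 0) c n + sumBelow (λ i → sumOver (W (suc i)) c n) k
    ≡⟨ cong (sumOver (W 0) c n +_) (sumBelow-sumOver-comm (W ∘ suc) c n k) ⟩
  sumOver (W 0) c n + sumOver (λ x → sumBelow (λ i → W (suc i) x) k) c n
    ≡⟨ sumOver-distrib-+ (W 0) _ c n ⟨
  sumOver (λ x → W 0 x + sumBelow (λ i → W (suc i) x) k) c n
    ∎
  where open ≡-Reasoning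

sum-map-upTo : ∀ (f g h : ℕ → ℕ) n → sum (map f (map g (applyUpTo h n))) ≡ sumBelow (λ x → f (g (h x))) n
sum-map-upTo f g h zero    = refl
sum-map-upTo f g h (suc n) = cong (f (g (h 0)) +_) (sum-map-upTo f g (h ∘ suc) n)

length-filter-upTo : ∀ {P : ℕ → Set} (P? : Decidable P) (g h : ℕ → ℕ) n →
                     length (filter P? (map g (applyUpTo h n))) ≡ sumBelow (λ x → 𝟙 (does (P? (g (h x))))) n
length-filter-upTo P? g h zero    = refl
length-filter-upTo P? g h (suc n) with does (P? (g (h 0)))
... | true  = cong suc (length-filter-upTo P? g (h ∘ suc) n)
... | false = length-filter-upTo P? g (h ∘ suc) n

sumRange≡sumBelow : ∀ a b f → sumRange a b f ≡ sumBelow (λ x → f (a + x)) (suc b ∸ a)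
sumRange≡sumBelow a b f = sum-map-upTo f (a +_) id (suc b ∸ a)

sumRange-suc : ∀ a b f → a ≤ suc b → sumRange a (suc b) f ≡ sumRange a b f + f (suc b)
sumRange-suc a b f a≤1+b = begin
  sumRange a (suc b) f                                  ≡⟨ sumRange≡sumBelow a (suc b) f ⟩
  sumBelow (λ x → f (a + x)) (suc (suc b) ∸ a)          ≡⟨ cong (sumBelow _) (+-∸-assoc 1 a≤1+b) ⟩
  sumBelow (λ x → f (a + x)) (suc (suc b ∸ a))          ≡⟨ sumBelow-suc _ (suc b ∸ a) ⟩
  sumBelow (λ x → f (a + x)) (suc b ∸ a) + f (a + (suc b ∸ a))
                                                        ≡⟨ cong₂ _+_ (sym (sumRange≡sumBelow a b f)) (cong f (m+[n∸m]≡n a≤1+b)) ⟩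
  sumRange a b f + f (suc b)                            ∎
  where open ≡-Reasoning

sumRange-empty : ∀ a f → sumRange (suc a) a f ≡ 0
sumRange-empty a f = trans (sumRange≡sumBelow (suc a) a f) (cong (sumBelow _) (n∸n≡0 a))

-- Parity

even? : ℕ → Bool
even? x = 2 ∣ᵇ x

Alternating : (ℕ → Bool) → Set
Alternating f = ∀ x → f (suc x) ≡ not (f x)

even?-alternating : Alternating even?
even?-alternating zero          = refl
even?-alternating (suc zero)    = refl
even?-alternating (suc (suc x)) = begin
  even? (3 + x)       ≡⟨ even?-+2 (suc x) ⟩
  even? (suc x)       ≡⟨ even?-alternating x ⟩
  not (even? x)       ≡⟨ cong not (even?-+2 x) ⟨
  not (even? (2 + x)) ∎
  where
  open ≡-Reasoning
  even?-+2 : ∀ y → even? (2 + y) ≡ even? y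
  even?-+2 y = does-⇔ (mk⇔ (λ 2∣2+y → ∣m+n∣m⇒∣n 2∣2+y ∣-refl) (∣m∣n⇒∣m+n ∣-refl)) (2 ∣? (2 + y)) (2 ∣? y)

odd-alternating : Alternating (survives 1)
odd-alternating x = cong not (even?-alternating x)

module _ {f : ℕ → Bool} (alt : Alternating f) where

  count-alternating-+2 : ∀ c n → count f c (2 + n) ≡ 1 + count f c n
  count-alternating-+2 c n = begin
    𝟙 (f (suc c)) + (𝟙 (f (2 + c)) + count f (2 + c) n) ≡⟨ +-assoc (𝟙 (f (suc c))) _ _ ⟨
    𝟙 (f (suc c)) + 𝟙 (f (2 + c)) + count f (2 + c) n   ≡⟨ cong₂ _+_ first-pair (sumOver-shift 2 _ 2-periodic c n) ⟩
    1 + count f c n                                     ∎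
    where
    open ≡-Reasoning
    first-pair : 𝟙 (f (suc c)) + 𝟙 (f (2 + c)) ≡ 1
    first-pair = trans (cong (λ b → 𝟙 (f (suc c)) + 𝟙 b) (alt (suc c))) (𝟙-not (f (suc c)))
    2-periodic : ∀ x → 𝟙 (f (2 + x)) ≡ 𝟙 (f x)
    2-periodic x = cong 𝟙 (trans (alt (suc x)) (trans (cong not (alt x)) (not-involutive (f x))))

  count-alternating-even : ∀ c a → count f c (a * 2) ≡ a
  count-alternating-even c zero    = refl
  count-alternating-even c (suc a) = trans (count-alternating-+2 c (a * 2)) (cong suc (count-alternating-even c a))

  count-alternating-odd : ∀ c a → count f c (1 + a * 2) ≡ a + 𝟙 (f (suc c))
  count-alternating-odd c a = trans (cong (𝟙 (f (suc c)) +_) (count-alternating-even (suc c) a)) (+-comm _ a)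

even-or-odd : ∀ q → (q ≡ q / 2 * 2 × even? q ≡ true) ⊎ (q ≡ 1 + q / 2 * 2 × even? q ≡ false)
even-or-odd q with 2 ∣? q
... | yes 2∣q = inj₁ (sym (m/n*n≡m 2∣q) , dec-true (2 ∣? q) 2∣q)
... | no  2∤q = inj₂ (trans (m≡m%n+[m/n]*n q 2) (cong (_+ q / 2 * 2) q%2≡1) , dec-false (2 ∣? q) 2∤q)
  where
  q%2≡1 : q % 2 ≡ 1
  q%2≡1 with q % 2 | m%n<n q 2 | m%n≡0⇒n∣m q 2
  ... | 0 | _             | 2∣q = ⊥-elim (2∤q (2∣q refl))
  ... | 1 | _             | _   = refl
  ... | suc (suc _) | s≤s (s≤s ()) | _

a+a≡a*2 : ∀ a → a + a ≡ a * 2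
a+a≡a*2 = solve-∀

a+1+a≡1+a*2 : ∀ a → a + 1 + a ≡ suc (a * 2)
a+1+a≡1+a*2 = solve-∀

a+a+1≡1+a*2 : ∀ a → a + a + 1 ≡ suc (a * 2)
a+a+1≡1+a*2 = solve-∀

a+w+a+1≡1+a*2+w : ∀ a w → a + w + a + 1 ≡ suc (a * 2) + w
a+w+a+1≡1+a*2+w = solve-∀

count-odd-≤ : ∀ c n → count (survives 1) c n + n / 2 ≤ n
count-odd-≤ c n with even-or-odd n
... | inj₁ (n≡ , _) = ≤-reflexive (begin
  count (survives 1) c n + n / 2             ≡⟨ cong (λ m → count (survives 1) c m + n / 2) n≡ ⟩
  count (survives 1) c (n / 2 * 2) + n / 2   ≡⟨ cong (_+ n / 2) (count-alternating-even odd-alternating c (n / 2)) ⟩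
  n / 2 + n / 2                              ≡⟨ a+a≡a*2 (n / 2) ⟩
  n / 2 * 2                                  ≡⟨ n≡ ⟨
  n                                          ∎)
  where open ≡-Reasoning
... | inj₂ (n≡ , _) = begin
  count (survives 1) c n + n / 2               ≡⟨ cong (λ m → count (survives 1) c m + n / 2) n≡ ⟩
  count (survives 1) c (1 + n / 2 * 2) + n / 2 ≡⟨ cong (_+ n / 2) (count-alternating-odd odd-alternating c (n / 2)) ⟩
  n / 2 + 𝟙 (survives 1 (suc c)) + n / 2       ≤⟨ +-monoˡ-≤ (n / 2) (+-monoʳ-≤ (n / 2) (𝟙≤1 _)) ⟩
  n / 2 + 1 + n / 2                            ≡⟨ cong (_+ n / 2) (+-comm (n / 2) 1) ⟩
  1 + (n / 2 + n / 2)                          ≡⟨ cong suc (a+a≡a*2 (n / 2)) ⟩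
  1 + n / 2 * 2                                ≡⟨ n≡ ⟨
  n                                            ∎
  where open ≤-Reasoning

-- Multiples of d in a window

[1+m]/n : ∀ m n .{{_ : NonZero n}} → (n ∣ suc m × suc m / n ≡ suc (m / n)) ⊎ (¬ n ∣ suc m × suc m / n ≡ m / n)
[1+m]/n m n with m≤n⇒m<n∨m≡n (m%n<n m n)
... | inj₁ 1+m%n<n = inj₂ (n∤1+m , 1+m/n≡m/n)
  where
  1+m≡ : suc m ≡ suc (m % n) + m / n * n
  1+m≡ = cong suc (m≡m%n+[m/n]*n m n)
  1+m/n≡m/n : suc m / n ≡ m / n
  1+m/n≡m/n = begin
    suc m / n                              ≡⟨ cong (_/ n) 1+m≡ ⟩
    (suc (m % n) + m / n * n) / n          ≡⟨ +-distrib-/-∣ʳ (suc (m % n)) (n∣m*n (m / n)) ⟩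
    suc (m % n) / n + m / n * n / n        ≡⟨ cong₂ _+_ (m<n⇒m/n≡0 1+m%n<n) (m*n/n≡m (m / n) n) ⟩
    m / n                                  ∎
    where open ≡-Reasoning
  n∤1+m : ¬ n ∣ suc m
  n∤1+m n∣1+m = <⇒≱ 1+m%n<n (∣⇒≤ (∣m+n∣m⇒∣n (subst (n ∣_) (trans 1+m≡ (+-comm _ (m / n * n))) n∣1+m) (n∣m*n (m / n))))
... | inj₂ 1+m%n≡n = inj₁ (divides (suc (m / n)) 1+m≡ , trans (cong (_/ n) 1+m≡) (m*n/n≡m (suc (m / n)) n))
  where
  1+m≡ : suc m ≡ suc (m / n) * n
  1+m≡ = trans (cong suc (m≡m%n+[m/n]*n m n)) (cong (_+ m / n * n) 1+m%n≡n)

[1+m]/n≡1+m/n : ∀ m n .{{_ : NonZero n}} → n ∣ suc m → suc m / n ≡ suc (m / n)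
[1+m]/n≡1+m/n m n n∣1+m with [1+m]/n m n
... | inj₁ (_ , eq)   = eq
... | inj₂ (n∤1+m , _) = ⊥-elim (n∤1+m n∣1+m)

[1+m]/n≡m/n : ∀ m n .{{_ : NonZero n}} → ¬ n ∣ suc m → suc m / n ≡ m / n
[1+m]/n≡m/n m n n∤1+m with [1+m]/n m n
... | inj₁ (n∣1+m , _) = ⊥-elim (n∤1+m n∣1+m)
... | inj₂ (_ , eq)    = eq

count-multiples : ∀ d .{{_ : NonZero d}} (g h : ℕ → Bool) → (∀ x → d ∣ x → g x ≡ h (x / d)) → ∀ c n →
                  count (λ x → d ∣ᵇ x ∧ g x) c n ≡ count h (c / d) ((c + n) / d ∸ c / d)
count-multiples d g h g≡h c zero    =
  cong (count h (c / d)) (sym (trans (cong (λ x → x / d ∸ c / d) (+-identityʳ c)) (n∸n≡0 (c / d))))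
count-multiples d g h g≡h c (suc n) = begin
  count f c (suc n)                     ≡⟨ sumOver-suc _ c n ⟩
  count f c n + 𝟙 (f (c + suc n))       ≡⟨ cong₂ _+_ (count-multiples d g h g≡h c n) (cong (𝟙 ∘ f) (+-suc c n)) ⟩
  count h A (X / d ∸ A) + 𝟙 (f (suc X)) ≡⟨ last-step (d ∣? suc X) ⟩
  count h A (suc X / d ∸ A)             ≡⟨ cong (λ x → count h A (x / d ∸ A)) (+-suc c n) ⟨
  count h A ((c + suc n) / d ∸ A)       ∎
  where
  open ≡-Reasoning
  f = λ x → d ∣ᵇ x ∧ g x
  A = c / d
  X = c + n
  A≤X/d : A ≤ X / d
  A≤X/d = /-monoˡ-≤ d (m≤m+n c n)
  last-step : Dec (d ∣ suc X) → count h A (X / d ∸ A) + 𝟙 (f (suc X)) ≡ count h A (suc X / d ∸ A)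
  last-step (no d∤) = begin
    count h A (X / d ∸ A) + 𝟙 (f (suc X)) ≡⟨ cong (λ b → count h A (X / d ∸ A) + 𝟙 (b ∧ g (suc X))) (dec-false (d ∣? suc X) d∤) ⟩
    count h A (X / d ∸ A) + 0             ≡⟨ +-identityʳ _ ⟩
    count h A (X / d ∸ A)                 ≡⟨ cong (λ x → count h A (x ∸ A)) ([1+m]/n≡m/n X d d∤) ⟨
    count h A (suc X / d ∸ A)             ∎
  last-step (yes d∣) = begin
    count h A (X / d ∸ A) + 𝟙 (f (suc X))                ≡⟨ cong (λ b → count h A (X / d ∸ A) + 𝟙 (b ∧ g (suc X))) (dec-true (d ∣? suc X) d∣) ⟩
    count h A (X / d ∸ A) + 𝟙 (g (suc X))                ≡⟨ cong (λ b → count h A (X / d ∸ A) + 𝟙 b) (g≡h (suc X) d∣) ⟩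
    count h A (X / d ∸ A) + 𝟙 (h (suc X / d))            ≡⟨ cong (λ x → count h A (X / d ∸ A) + 𝟙 (h x)) 1+X/d≡′ ⟩
    count h A (X / d ∸ A) + 𝟙 (h (A + suc (X / d ∸ A)))  ≡⟨ sumOver-suc _ A (X / d ∸ A) ⟨
    count h A (suc (X / d ∸ A))                          ≡⟨ cong (count h A) (+-∸-assoc 1 A≤X/d) ⟨
    count h A (suc (X / d) ∸ A)                          ≡⟨ cong (λ x → count h A (x ∸ A)) 1+X/d≡ ⟨
    count h A (suc X / d ∸ A)                            ∎
    where
    1+X/d≡ = [1+m]/n≡1+m/n X d d∣
    1+X/d≡′ : suc X / d ≡ A + suc (X / d ∸ A)
    1+X/d≡′ = trans 1+X/d≡ (trans (cong suc (sym (m+[n∸m]≡n A≤X/d))) (sym (+-suc A _)))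

m/n+o/n≤[m+o]/n : ∀ m o n .{{_ : NonZero n}} → m / n + o / n ≤ (m + o) / n
m/n+o/n≤[m+o]/n m o n = begin
  m / n + o / n                 ≡⟨ m*n/n≡m (m / n + o / n) n ⟨
  (m / n + o / n) * n / n       ≡⟨ cong (_/ n) (*-distribʳ-+ n (m / n) (o / n)) ⟩
  (m / n * n + o / n * n) / n   ≤⟨ /-monoˡ-≤ n (+-mono-≤ (m/n*n≤m m n) (m/n*n≤m o n)) ⟩
  (m + o) / n                   ∎
  where open ≤-Reasoning

multiples-window-≥ : ∀ c r d .{{_ : NonZero d}} → r / d ≤ (c + r) / d ∸ c / d
multiples-window-≥ c r d = begin
  r / d                     ≡⟨ m+n∸m≡n (c / d) (r / d) ⟨
  c / d + r / d ∸ c / d     ≤⟨ ∸-monoˡ-≤ (c / d) (m/n+o/n≤[m+o]/n c r d) ⟩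
  (c + r) / d ∸ c / d       ∎
  where open ≤-Reasoning

multiples-window-suc : ∀ c r d .{{_ : NonZero d}} → d ∣ suc c → ¬ d ∣ r → suc (r / d) ≤ (c + r) / d ∸ c / d
multiples-window-suc c zero       d _     d∤r = ⊥-elim (d∤r (d ∣0))
multiples-window-suc c (suc r′) d d∣1+c d∤r = ≤-reflexive (sym (begin
  (c + suc r′) / d ∸ c / d         ≡⟨ cong (λ x → x / d ∸ c / d) (+-suc c r′) ⟩
  (suc c + r′) / d ∸ c / d         ≡⟨ cong (_∸ c / d) (+-distrib-/-∣ˡ r′ d∣1+c) ⟩
  suc c / d + r′ / d ∸ c / d       ≡⟨ cong (λ x → x + r′ / d ∸ c / d) ([1+m]/n≡1+m/n c d d∣1+c) ⟩
  suc (c / d + r′ / d) ∸ c / d     ≡⟨ +-∸-assoc 1 (m≤m+n (c / d) _) ⟩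
  suc (c / d + r′ / d ∸ c / d)     ≡⟨ cong suc (m+n∸m≡n (c / d) _) ⟩
  suc (r′ / d)                     ≡⟨ cong suc ([1+m]/n≡m/n r′ d d∤r) ⟨
  suc (suc r′ / d)                 ∎))
  where open ≡-Reasoning

ceilDiv-∣ : ∀ r d .{{_ : NonZero d}} → d ∣ r → ceilDiv r d ≡ r / d
ceilDiv-∣ r d d∣r = begin
  (r + (d ∸ 1)) / d      ≡⟨ +-distrib-/-∣ˡ (d ∸ 1) d∣r ⟩
  r / d + (d ∸ 1) / d    ≡⟨ cong (r / d +_) (m<n⇒m/n≡0 (≤-reflexive (suc-pred d))) ⟩
  r / d + 0              ≡⟨ +-identityʳ (r / d) ⟩
  r / d                  ∎
  where open ≡-Reasoning

ceilDiv-∤ : ∀ r d .{{_ : NonZero d}} → ¬ d ∣ r → ceilDiv r d ≡ suc (r / d)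
ceilDiv-∤ zero    d d∤0 = ⊥-elim (d∤0 (d ∣0))
ceilDiv-∤ (suc r) d d∤r = begin
  (suc r + (d ∸ 1)) / d  ≡⟨ cong (_/ d) (trans (sym (+-suc r (d ∸ 1))) (cong (r +_) (suc-pred d))) ⟩
  (r + d) / d            ≡⟨ +-distrib-/-∣ʳ r ∣-refl ⟩
  r / d + d / d          ≡⟨ cong₂ _+_ (sym ([1+m]/n≡m/n r d d∤r)) (n/n≡1 d) ⟩
  suc r / d + 1          ≡⟨ +-comm _ 1 ⟩
  suc (suc r / d)        ∎
  where open ≡-Reasoning

-- φ and φ_min as counts of survivors

phiInt≡count : ∀ y n t → phiInt (ℤ.+ y) n t ≡ count (survives t) y n
phiInt≡count y n t = begin
  phiInt (ℤ.+ y) n t                                              ≡⟨ length-filter-upTo _ suc id n ⟩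
  sumBelow (λ x → 𝟙 (does (gcd (y + suc x) (P t) ≟ 1))) n          ≡⟨ sumBelow-cong n (λ x _ → cong 𝟙 (gcd≟1≡survives t (y + suc x))) ⟩
  sumBelow (λ x → 𝟙 (survives t (y + suc x))) n                    ≡⟨ sumBelow-sumOver _ y n ⟩
  count (survives t) y n                                          ∎
  where open ≡-Reasoning

totient≡count : ∀ t → totient (P t) ≡ count (survives t) 0 (P t)
totient≡count t = trans (length-filter-upTo _ suc id (P t))
  (trans (sumBelow-cong (P t) (λ x _ → cong 𝟙 (gcd≟1≡survives t (suc x)))) (sumBelow-sumOver _ 0 (P t)))

PhiMinimum : (ℕ → ℕ → ℕ) → Set
PhiMinimum fmin = (n t : ℕ) → 1 ≤ t → IsPhiMin n t (fmin n t)

module _ {fmin : ℕ → ℕ → ℕ} (isMin : PhiMinimum fmin) where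

  fmin≤count : ∀ n t y → 1 ≤ t → fmin n t ≤ count (survives t) y n
  fmin≤count n t y 1≤t = subst (fmin n t ≤_) (phiInt≡count y n t) (proj₂ (isMin n t 1≤t) (ℤ.+ y))

  module _ (d : ℕ) .{{_ : NonZero d}} (t : ℕ) (1≤t : 1 ≤ t) (survives-/ : ∀ x → d ∣ x → survives t x ≡ survives t (x / d))
           (c r : ℕ) where

    multiples-count-≥ : fmin (r / d) t ≤ count (λ x → d ∣ᵇ x ∧ survives t x) c r
    multiples-count-≥ = begin
      fmin (r / d) t                                       ≤⟨ fmin≤count (r / d) t (c / d) 1≤t ⟩
      count (survives t) (c / d) (r / d)                   ≤⟨ sumOver-monoʳ-≤ _ (c / d) (multiples-window-≥ c r d) ⟩
      count (survives t) (c / d) ((c + r) / d ∸ c / d)     ≡⟨ count-multiples d _ _ survives-/ c r ⟨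
      count (λ x → d ∣ᵇ x ∧ survives t x) c r              ∎
      where open ≤-Reasoning

    multiples-count-≥-suc : d ∣ suc c → ¬ d ∣ r → survives t (suc c) ≡ true →
                            suc (fmin (r / d) t) ≤ count (λ x → d ∣ᵇ x ∧ survives t x) c r
    multiples-count-≥-suc d∣1+c d∤r survives-1+c = begin
      1 + fmin (r / d) t                                   ≤⟨ +-mono-≤ (≤-reflexive (cong 𝟙 (sym first-survives))) (fmin≤count (r / d) t (suc A) 1≤t) ⟩
      𝟙 (survives t (suc A)) + count (survives t) (suc A) (r / d)
                                                           ≡⟨⟩
      count (survives t) A (suc (r / d))                   ≤⟨ sumOver-monoʳ-≤ _ A (multiples-window-suc c r d d∣1+c d∤r) ⟩
      count (survives t) A ((c + r) / d ∸ A)               ≡⟨ count-multiples d _ _ survives-/ c r ⟨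
      count (λ x → d ∣ᵇ x ∧ survives t x) c r              ∎
      where
      open ≤-Reasoning
      A = c / d
      first-survives : survives t (suc A) ≡ true
      first-survives = trans (cong (survives t) (sym ([1+m]/n≡1+m/n c d d∣1+c)))
                             (trans (sym (survives-/ (suc c) d∣1+c)) survives-1+c)

-- Odd multiples of a new prime

-- Definitionally the condition counted by Ecount.
exceptional-dec : ∀ r i → Dec (¬ p i ∣ r × ((2 ∣ r ∸ _%_ r (p i) {{p-nonZero i}} + p i) ⊎ (p i ∣ ∣ (ℤ.+ r ℤ.- ℤ.+ 1) ∣)))
exceptional-dec r i = ¬? (p i ∣? r) ×-dec
  ((2 ∣? (r ∸ _%_ r (p i) {{p-nonZero i}} + p i)) ⊎-dec (p i ∣? ∣ (ℤ.+ r ℤ.- ℤ.+ 1) ∣))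

exceptional? : ℕ → ℕ → Bool
exceptional? r i = does (exceptional-dec r i)

Ecount≡sumBelow : ∀ k r → Ecount k r ≡ sumBelow (λ x → 𝟙 (exceptional? r (2 + x))) (k ∸ 1)
Ecount≡sumBelow k r = length-filter-upTo _ (2 +_) id (k ∸ 1)

quotient-odd : ∀ r d .{{_ : NonZero d}} → ¬ 2 ∣ d → 2 ∣ r ∸ r % d + d → even? (r / d) ≡ false
quotient-odd r d 2∤d 2∣ = begin
  even? (r / d)             ≡⟨ not-involutive _ ⟨
  not (not (even? (r / d))) ≡⟨ cong not (even?-alternating (r / d)) ⟨
  not (even? (suc (r / d))) ≡⟨ cong not (dec-true (2 ∣? suc (r / d)) 2∣1+r/d) ⟩
  false                     ∎
  where
  open ≡-Reasoning
  r∸r%d+d≡ : r ∸ r % d + d ≡ suc (r / d) * d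
  r∸r%d+d≡ = begin
    r ∸ r % d + d                      ≡⟨ cong (λ x → x ∸ r % d + d) (m≡m%n+[m/n]*n r d) ⟩
    r % d + r / d * d ∸ r % d + d      ≡⟨ cong (_+ d) (m+n∸m≡n (r % d) _) ⟩
    r / d * d + d                      ≡⟨ +-comm _ d ⟩
    suc (r / d) * d                    ∎
  2∣1+r/d : 2 ∣ suc (r / d)
  2∣1+r/d = [ id , (λ 2∣d → ⊥-elim (2∤d 2∣d)) ]′ (euclidsLemma (suc (r / d)) d prime[2] (subst (2 ∣_) r∸r%d+d≡ 2∣))

∣pred⇒%≡1 : ∀ r d .{{_ : NonZero d}} → 2 ≤ d → ¬ d ∣ r → d ∣ ∣ (ℤ.+ r ℤ.- ℤ.+ 1) ∣ → r % d ≡ 1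
∣pred⇒%≡1 zero    d _   d∤0 _   = ⊥-elim (d∤0 (d ∣0))
∣pred⇒%≡1 (suc r) d 2≤d _   d∣r = trans (%-remove-+ʳ 1 d∣r) (m<n⇒m%n≡m 2≤d)

module OddMultiples (t c r : ℕ) where

  p′ : ℕ
  p′ = p (2 + t)

  instance
    p′≢0 : NonZero p′
    p′≢0 = p-nonZero (2 + t)

  q s c′ u carry : ℕ
  q = r / p′
  s = r % p′
  c′ = c / p′
  u = c % p′
  carry = (u + s) / p′

  window≡ : (c + r) / p′ ∸ c′ ≡ q + carry
  window≡ = begin
    (c + r) / p′ ∸ c′                          ≡⟨ cong (λ x → x / p′ ∸ c′) c+r≡ ⟩
    ((u + s) + (c′ + q) * p′) / p′ ∸ c′        ≡⟨ cong (_∸ c′) (+-distrib-/-∣ʳ (u + s) (n∣m*n (c′ + q))) ⟩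
    (carry + (c′ + q) * p′ / p′) ∸ c′          ≡⟨ cong (λ x → carry + x ∸ c′) (m*n/n≡m (c′ + q) p′) ⟩
    (carry + (c′ + q)) ∸ c′                    ≡⟨ cong (_∸ c′) (trans (+-comm carry _) (+-assoc c′ q carry)) ⟩
    c′ + (q + carry) ∸ c′                      ≡⟨ m+n∸m≡n c′ (q + carry) ⟩
    q + carry                                  ∎
    where
    open ≡-Reasoning
    c+r≡ : c + r ≡ (u + s) + (c′ + q) * p′
    c+r≡ = begin
      c + r                              ≡⟨ cong₂ _+_ (m≡m%n+[m/n]*n c p′) (m≡m%n+[m/n]*n r p′) ⟩
      (u + c′ * p′) + (s + q * p′)       ≡⟨ +-interchange u (c′ * p′) s (q * p′) ⟩
      (u + s) + (c′ * p′ + q * p′)       ≡⟨ cong ((u + s) +_) (*-distribʳ-+ p′ c′ q) ⟨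
      (u + s) + (c′ + q) * p′            ∎

  carry≤1 : carry ≤ 1
  carry≤1 = s≤s⁻¹ (m<n*o⇒m/o<n (begin-strict
    u + s        <⟨ +-mono-<-≤ (m%n<n c p′) (<⇒≤ (m%n<n r p′)) ⟩
    p′ + p′      ≡⟨ cong (p′ +_) (+-identityʳ p′) ⟨
    2 * p′       ∎))
    where open ≤-Reasoning

  carry≡0 : p′ ∣ r → carry ≡ 0
  carry≡0 p′∣r = begin
    (u + s) / p′ ≡⟨ cong (λ x → (u + x) / p′) (n∣m⇒m%n≡0 r p′ p′∣r) ⟩
    (u + 0) / p′ ≡⟨ cong (_/ p′) (+-identityʳ u) ⟩
    u / p′       ≡⟨ m<n⇒m/n≡0 (m%n<n c p′) ⟩
    0            ∎
    where open ≡-Reasoning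

  odd-multiples≡ : count (λ x → p′ ∣ᵇ x ∧ survives 1 x) c r ≡ count (survives 1) c′ (q + carry)
  odd-multiples≡ = trans
    (count-multiples p′ (survives 1) (survives 1) (λ x p′∣x → sym (survives-/p 1 (2 + t) x (s≤s (s≤s z≤n)) p′∣x)) c r)
    (cong (count (survives 1) c′) window≡)

  r/2p′≡q/2 : r / (2 * p′) ≡ q / 2
  r/2p′≡q/2 = trans (/-congʳ {m = r} (*-comm 2 p′)) (sym (m/n/o≡m/[n*o] r p′ 2))

  E : Bool
  E = exceptional? r (2 + t)

  E⇒ : E ≡ true → ¬ p′ ∣ r × (even? q ≡ false ⊎ s ≡ 1)
  E⇒ E≡true with dec-true⁻¹ (exceptional-dec r (2 + t)) E≡true
  ... | p′∤r , inj₁ 2∣ = p′∤r , inj₁ (quotient-odd r p′ (p-odd (2 + t) (s≤s (s≤s z≤n))) 2∣)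
  ... | p′∤r , inj₂ p′∣ = p′∤r , inj₂ (∣pred⇒%≡1 r p′ (p≥2 (2 + t)) p′∤r p′∣)

  -- c even, r odd, p′ ∣ c + 1 and r ≡ 1 (mod p′): both ends c + 1 and c + r of the window
  -- are odd multiples of p′.
  endsOnOddMultiples : Bool
  endsOnOddMultiples = (even? c ∧ survives 1 r) ∧ (p′ ∣ᵇ suc c ∧ does (s ≟ 1))

  endsOnOddMultiples-intro : s ≡ 1 → carry ≡ 1 → q ≡ q / 2 * 2 → survives 1 (suc c′) ≡ true → endsOnOddMultiples ≡ true
  endsOnOddMultiples-intro s≡1 carry≡1 q≡ 1+c′-odd = cong₂ _∧_
    (cong₂ _∧_ c-even r-odd)
    (cong₂ _∧_ (dec-true (p′ ∣? suc c) (divides (suc c′) 1+c≡)) (dec-true (s ≟ 1) s≡1))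
    where
    open ≡-Reasoning
    1+u≡p′ : suc u ≡ p′
    1+u≡p′ = ≤-antisym (m%n<n c p′) (subst (p′ ≤_) (+-comm u 1) (m/n≢0⇒n≤m (λ eq → 0≢1+n (trans (sym eq) [u+1]/p′≡1))))
      where
      [u+1]/p′≡1 : (u + 1) / p′ ≡ 1
      [u+1]/p′≡1 = trans (cong (λ x → (u + x) / p′) (sym s≡1)) carry≡1
    1+c≡ : suc c ≡ suc c′ * p′
    1+c≡ = trans (cong suc (m≡m%n+[m/n]*n c p′)) (cong (_+ c′ * p′) 1+u≡p′)
    odd-suc : ∀ x → 2 ∣ x → survives 1 (suc x) ≡ true
    odd-suc x 2∣x = trans (cong not (even?-alternating x)) (trans (not-involutive _) (dec-true (2 ∣? x) 2∣x))
    c-even : even? c ≡ true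
    c-even = begin
      even? c                   ≡⟨ not-involutive _ ⟨
      not (not (even? c))       ≡⟨ cong not (even?-alternating c) ⟨
      survives 1 (suc c)        ≡⟨ cong (survives 1) 1+c≡ ⟩
      survives 1 (suc c′ * p′)  ≡⟨ survives-*p 1 (2 + t) (suc c′) (s≤s (s≤s z≤n)) ⟩
      survives 1 (suc c′)       ≡⟨ 1+c′-odd ⟩
      true                      ∎
    r-odd : survives 1 r ≡ true
    r-odd = begin
      survives 1 r                        ≡⟨ cong (survives 1) (m≡m%n+[m/n]*n r p′) ⟩
      survives 1 (s + q * p′)             ≡⟨ cong (λ x → survives 1 (x + q * p′)) s≡1 ⟩
      survives 1 (suc (q * p′))           ≡⟨ odd-suc (q * p′) (∣-trans (divides (q / 2) q≡) (m∣m*n p′)) ⟩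
      true                                ∎

  endsOnOddMultiples⇒ : endsOnOddMultiples ≡ true → (even? c ∧ survives 1 r) ≡ true × p′ ∣ suc c × s ≡ 1
  endsOnOddMultiples⇒ W≡true with ∧≡true⁻ W≡true
  ... | Q≡true , D∧S≡true with ∧≡true⁻ D∧S≡true
  ...   | D≡true , S≡true = Q≡true , dec-true⁻¹ (p′ ∣? suc c) D≡true , dec-true⁻¹ (s ≟ 1) S≡true

  odd-multiples-bound : count (λ x → p′ ∣ᵇ x ∧ survives 1 x) c r + r / (2 * p′) + 𝟙 E ≤ ceilDiv r p′ + 𝟙 endsOnOddMultiples
  odd-multiples-bound = subst (_≤ ceilDiv r p′ + 𝟙 W) (sym (cong₂ (λ x y → x + y + 𝟙 E) odd-multiples≡ r/2p′≡q/2)) bound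
    where
    W = endsOnOddMultiples
    O : ℕ → ℕ
    O = count (survives 1) c′
    a = q / 2
    E≡false : (¬ p′ ∣ r → even? q ≡ false ⊎ s ≡ 1 → ⊥) → E ≡ false
    E≡false ¬E = ¬-not (λ E≡true → uncurry ¬E (E⇒ E≡true))
    O-carry≤ : O (q + carry) ≤ O (suc q)
    O-carry≤ = sumOver-monoʳ-≤ _ c′ (≤-trans (+-monoʳ-≤ q carry≤1) (≤-reflexive (+-comm q 1)))
    bound : O (q + carry) + a + 𝟙 E ≤ ceilDiv r p′ + 𝟙 W
    bound with p′ ∣? r
    ... | yes p′∣r = begin
      O (q + carry) + a + 𝟙 E ≡⟨ cong₂ (λ x b → O (q + x) + a + 𝟙 b) (carry≡0 p′∣r) (E≡false (λ p′∤r _ → p′∤r p′∣r)) ⟩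
      O (q + 0) + a + 0       ≡⟨ cong (λ x → O x + a + 0) (+-identityʳ q) ⟩
      O q + a + 0             ≡⟨ +-identityʳ _ ⟩
      O q + a                 ≤⟨ count-odd-≤ c′ q ⟩
      q                       ≡⟨ ceilDiv-∣ r p′ p′∣r ⟨
      ceilDiv r p′            ≤⟨ m≤m+n _ _ ⟩
      ceilDiv r p′ + 𝟙 W      ∎
      where open ≤-Reasoning
    ... | no p′∤r = subst (λ x → O (q + carry) + a + 𝟙 E ≤ x + 𝟙 W) (sym (ceilDiv-∤ r p′ p′∤r)) (inexact (even-or-odd q))
      where
      open ≤-Reasoning
      inexact : (q ≡ a * 2 × even? q ≡ true) ⊎ (q ≡ 1 + a * 2 × even? q ≡ false) → O (q + carry) + a + 𝟙 E ≤ suc q + 𝟙 W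
      inexact (inj₂ (q≡ , _)) = begin
        O (q + carry) + a + 𝟙 E     ≤⟨ +-mono-≤ (+-monoˡ-≤ a O-carry≤) (𝟙≤1 E) ⟩
        O (suc q) + a + 1           ≡⟨ trans (+-assoc (O (suc q)) a 1) (cong (O (suc q) +_) (+-comm a 1)) ⟩
        O (suc q) + suc a           ≡⟨ cong (O (suc q) +_) (m*n/n≡m (suc a) 2) ⟨
        O (suc q) + suc a * 2 / 2   ≡⟨ cong (λ x → O (suc q) + x / 2) (cong suc q≡) ⟨
        O (suc q) + suc q / 2       ≤⟨ count-odd-≤ c′ (suc q) ⟩
        suc q                       ≤⟨ m≤m+n _ _ ⟩
        suc q + 𝟙 W                 ∎
      inexact (inj₁ (q≡ , q-even)) with s ≟ 1
      ... | no s≢1 = begin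
        O (q + carry) + a + 𝟙 E     ≡⟨ cong (λ b → O (q + carry) + a + 𝟙 b) (E≡false ¬E) ⟩
        O (q + carry) + a + 0       ≡⟨ +-identityʳ _ ⟩
        O (q + carry) + a           ≤⟨ +-monoˡ-≤ a O-carry≤ ⟩
        O (suc q) + a               ≡⟨ cong (λ x → O (suc x) + a) q≡ ⟩
        O (1 + a * 2) + a           ≡⟨ cong (_+ a) (count-alternating-odd odd-alternating c′ a) ⟩
        a + 𝟙 (survives 1 (suc c′)) + a ≤⟨ +-monoˡ-≤ a (+-monoʳ-≤ a (𝟙≤1 _)) ⟩
        a + 1 + a                   ≡⟨ a+1+a≡1+a*2 a ⟩
        suc (a * 2)                 ≡⟨ cong suc q≡ ⟨
        suc q                       ≤⟨ m≤m+n _ _ ⟩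
        suc q + 𝟙 W                 ∎
        where
        ¬E : ¬ p′ ∣ r → even? q ≡ false ⊎ s ≡ 1 → ⊥
        ¬E _ = [ not-¬ q-even , s≢1 ]′
      ... | yes s≡1 with m≤n⇒m<n∨m≡n carry≤1
      ...   | inj₁ carry<1 = begin
        O (q + carry) + a + 𝟙 E     ≤⟨ +-monoʳ-≤ _ (𝟙≤1 E) ⟩
        O (q + carry) + a + 1       ≡⟨ cong (λ x → O (q + x) + a + 1) (n<1⇒n≡0 carry<1) ⟩
        O (q + 0) + a + 1           ≡⟨ cong (λ x → O x + a + 1) (trans (+-identityʳ q) q≡) ⟩
        O (a * 2) + a + 1           ≡⟨ cong (λ x → x + a + 1) (count-alternating-even odd-alternating c′ a) ⟩
        a + a + 1                   ≡⟨ a+a+1≡1+a*2 a ⟩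
        suc (a * 2)                 ≡⟨ cong suc q≡ ⟨
        suc q                       ≤⟨ m≤m+n _ _ ⟩
        suc q + 𝟙 W                 ∎
      ...   | inj₂ carry≡1 = begin
        O (q + carry) + a + 𝟙 E     ≤⟨ +-monoʳ-≤ _ (𝟙≤1 E) ⟩
        O (q + carry) + a + 1       ≡⟨ cong (λ x → O x + a + 1) (trans (cong (q +_) carry≡1) (trans (+-comm q 1) (cong suc q≡))) ⟩
        O (1 + a * 2) + a + 1       ≡⟨ cong (λ x → x + a + 1) (count-alternating-odd odd-alternating c′ a) ⟩
        a + 𝟙 (survives 1 (suc c′)) + a + 1 ≤⟨ +-monoˡ-≤ 1 (+-monoˡ-≤ a (+-monoʳ-≤ a (𝟙-mono (endsOnOddMultiples-intro s≡1 carry≡1 q≡)))) ⟩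
        a + 𝟙 W + a + 1             ≡⟨ a+w+a+1≡1+a*2+w a (𝟙 W) ⟩
        suc (a * 2) + 𝟙 W           ≡⟨ cong (λ x → suc x + 𝟙 W) q≡ ⟨
        suc q + 𝟙 W                 ∎

-- Sieving by one more prime

p*p∣ᵇ : ∀ {i j} x → 1 ≤ i → 1 ≤ j → i ≢ j → p i * p j ∣ᵇ x ≡ (p i ∣ᵇ x ∧ p j ∣ᵇ x)
p*p∣ᵇ {i} {j} x 1≤i 1≤j i≢j = does-⇔
  (mk⇔ (λ pᵢpⱼ∣x → ∣-trans (m∣m*n (p j)) pᵢpⱼ∣x , ∣-trans (n∣m*n (p i)) pᵢpⱼ∣x) (uncurry (p*p∣ 1≤i 1≤j i≢j)))
  (p i * p j ∣? x) (p i ∣? x ×-dec p j ∣? x)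

-- An odd x either survives p₂, …, p₁₊ₜ or has exactly one of them as its least prime factor.
least-factor-partition : ∀ t x →
  𝟙 (survives (suc t) x) + sumBelow (λ y → 𝟙 (p (2 + y) ∣ᵇ x ∧ survives (suc y) x)) t ≡ 𝟙 (survives 1 x)
least-factor-partition zero    x = +-identityʳ _
least-factor-partition (suc t) x = begin
  𝟙 (A ∧ not D) + sumBelow F (suc t)             ≡⟨ cong (𝟙 (A ∧ not D) +_) (sumBelow-suc F t) ⟩
  𝟙 (A ∧ not D) + (sumBelow F t + 𝟙 (D ∧ A))     ≡⟨ cong (𝟙 (A ∧ not D) +_) (+-comm (sumBelow F t) _) ⟩
  𝟙 (A ∧ not D) + (𝟙 (D ∧ A) + sumBelow F t)     ≡⟨ +-assoc (𝟙 (A ∧ not D)) _ _ ⟨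
  𝟙 (A ∧ not D) + 𝟙 (D ∧ A) + sumBelow F t       ≡⟨ cong (λ b → 𝟙 (A ∧ not D) + 𝟙 b + sumBelow F t) (∧-comm D A) ⟩
  𝟙 (A ∧ not D) + 𝟙 (A ∧ D) + sumBelow F t       ≡⟨ cong (_+ sumBelow F t) (𝟙-split A D) ⟨
  𝟙 A + sumBelow F t                             ≡⟨ least-factor-partition t x ⟩
  𝟙 (survives 1 x)                               ∎
  where
  open ≡-Reasoning
  A = survives (suc t) x
  D = p (2 + t) ∣ᵇ x
  F = λ y → 𝟙 (p (2 + y) ∣ᵇ x ∧ survives (suc y) x)

multiples-least-factor : ∀ t x →
  𝟙 (survives (suc t) x ∧ p (2 + t) ∣ᵇ x) + sumBelow (λ y → 𝟙 (p (2 + y) * p (2 + t) ∣ᵇ x ∧ survives (suc y) x)) t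
  ≡ 𝟙 (p (2 + t) ∣ᵇ x ∧ survives 1 x)
multiples-least-factor t x = trans
  (cong (𝟙 (survives (suc t) x ∧ D) +_) (sumBelow-cong t λ y y<t →
    cong (λ b → 𝟙 (b ∧ survives (suc y) x)) (p*p∣ᵇ x (s≤s z≤n) (s≤s z≤n) (<⇒≢ (s<s (s<s y<t))))))
  (by-cases D)
  where
  D = p (2 + t) ∣ᵇ x
  by-cases : ∀ d → 𝟙 (survives (suc t) x ∧ d) + sumBelow (λ y → 𝟙 ((p (2 + y) ∣ᵇ x ∧ d) ∧ survives (suc y) x)) t
                 ≡ 𝟙 (d ∧ survives 1 x)
  by-cases true  = trans
    (cong₂ _+_ (cong 𝟙 (∧-identityʳ _)) (sumBelow-cong t λ y _ → cong (λ b → 𝟙 (b ∧ survives (suc y) x)) (∧-identityʳ (p (2 + y) ∣ᵇ x))))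
    (least-factor-partition t x)
  by-cases false = trans
    (cong₂ _+_ (cong 𝟙 (∧-zeroʳ _)) (sumBelow-cong t λ y _ → cong (λ b → 𝟙 (b ∧ survives (suc y) x)) (∧-zeroʳ (p (2 + y) ∣ᵇ x))))
    (sumBelow-const-0 t)
    where
    sumBelow-const-0 : ∀ n → 0 + sumBelow (λ _ → 0) n ≡ 0
    sumBelow-const-0 zero    = refl
    sumBelow-const-0 (suc n) = sumBelow-const-0 n

odd-multiples-split : ∀ t c r →
  count (λ x → survives (suc t) x ∧ p (2 + t) ∣ᵇ x) c r
    + sumBelow (λ y → count (λ x → p (2 + y) * p (2 + t) ∣ᵇ x ∧ survives (suc y) x) c r) t
  ≡ count (λ x → p (2 + t) ∣ᵇ x ∧ survives 1 x) c r
odd-multiples-split t c r = begin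
  count _ c r + sumBelow (λ y → count _ c r) t        ≡⟨ cong (count _ c r +_) (sumBelow-sumOver-comm _ c r t) ⟩
  count _ c r + sumOver (λ x → sumBelow _ t) c r      ≡⟨ sumOver-distrib-+ _ _ c r ⟨
  sumOver (λ x → 𝟙 _ + sumBelow _ t) c r              ≡⟨ sumOver-cong (multiples-least-factor t) c r ⟩
  count (λ x → p (2 + t) ∣ᵇ x ∧ survives 1 x) c r     ∎
  where open ≡-Reasoning

module SieveStep {fmin : ℕ → ℕ → ℕ} (isMin : PhiMinimum fmin) (t c r : ℕ) where

  open OddMultiples t c r using (p′; E; endsOnOddMultiples; endsOnOddMultiples⇒; odd-multiples-bound)

  W = endsOnOddMultiples
  Q = even? c ∧ survives 1 r

  N Z : ℕ
  N = count (λ x → survives (suc t) x ∧ p′ ∣ᵇ x) c r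
  Z = 𝟙 (Q ∧ (survives (suc t) (suc c) ∧ p′ ∣ᵇ suc c))

  G T Y : ℕ → ℕ
  G y = fmin (_/_ r (p (2 + y) * p′) {{m*n≢0 (p (2 + y)) p′ {{p-nonZero (2 + y)}} {{p-nonZero (2 + t)}}}}) (suc y)
  T y = count (λ x → p (2 + y) * p′ ∣ᵇ x ∧ survives (suc y) x) c r
  Y y = 𝟙 (W ∧ (p (2 + y) ∣ᵇ suc c ∧ survives (suc y) (suc c)))

  pair-multiples-bound : ∀ y → y < t → G y + Y y ≤ T y
  pair-multiples-bound y y<t = bound _ id
    where
    pᵧ d : ℕ
    pᵧ = p (2 + y)
    d = pᵧ * p′
    instance
      d≢0 : NonZero d
      d≢0 = m*n≢0 pᵧ p′ {{p-nonZero (2 + y)}} {{p-nonZero (2 + t)}}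
    survives-/ : ∀ x → d ∣ x → survives (suc y) x ≡ survives (suc y) (x / d)
    survives-/ x d∣x = sym (survives-/pp (suc y) (2 + y) (2 + t) x ≤-refl (s<s (s<s (<⇒≤ y<t))) d∣x)
    bound : ∀ b → (b ≡ true → (W ∧ (pᵧ ∣ᵇ suc c ∧ survives (suc y) (suc c))) ≡ true) → G y + 𝟙 b ≤ T y
    bound false _ = subst (_≤ T y) (sym (+-identityʳ _)) (multiples-count-≥ isMin d (suc y) (s≤s z≤n) survives-/ c r)
    bound true  h with ∧≡true⁻ (h refl)
    ... | W≡true , D∧S≡true with ∧≡true⁻ D∧S≡true | endsOnOddMultiples⇒ W≡true
    ...   | pᵧ∣ᵇ , survives-1+c | _ , p′∣1+c , r%p′≡1 =
      subst (_≤ T y) (+-comm 1 (G y))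
        (multiples-count-≥-suc isMin d (suc y) (s≤s z≤n) survives-/ c r d∣1+c d∤r survives-1+c)
      where
      d∣1+c : d ∣ suc c
      d∣1+c = p*p∣ (s≤s z≤n) (s≤s z≤n) (<⇒≢ (s<s (s<s y<t))) (dec-true⁻¹ (pᵧ ∣? suc c) pᵧ∣ᵇ) p′∣1+c
      d∤r : ¬ d ∣ r
      d∤r d∣r = 0≢1+n (trans (sym (n∣m⇒m%n≡0 r p′ {{p-nonZero (2 + t)}} (∣-trans (n∣m*n pᵧ) d∣r))) r%p′≡1)

  endpoint-correction : 𝟙 W ≤ Z + sumBelow Y t
  endpoint-correction = correction W id
    where
    A = survives (suc t) (suc c)
    D = p′ ∣ᵇ suc c
    F : ℕ → Bool
    F y = p (2 + y) ∣ᵇ suc c ∧ survives (suc y) (suc c)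
    correction : ∀ w → (w ≡ true → W ≡ true) → 𝟙 w ≤ 𝟙 (Q ∧ (A ∧ D)) + sumBelow (λ y → 𝟙 (w ∧ F y)) t
    correction false _ = z≤n
    correction true  h with endsOnOddMultiples⇒ (h refl)
    ... | Q≡true , p′∣1+c , _ = ≤-reflexive (sym (begin
      𝟙 (Q ∧ (A ∧ D)) + sumBelow (𝟙 ∘ F) t      ≡⟨ cong₂ (λ a b → 𝟙 (a ∧ (A ∧ b)) + sumBelow (𝟙 ∘ F) t) Q≡true (dec-true (p′ ∣? suc c) p′∣1+c) ⟩
      𝟙 (A ∧ true) + sumBelow (𝟙 ∘ F) t         ≡⟨ cong (λ a → 𝟙 a + sumBelow (𝟙 ∘ F) t) (∧-identityʳ A) ⟩
      𝟙 A + sumBelow (𝟙 ∘ F) t                  ≡⟨ least-factor-partition t (suc c) ⟩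
      𝟙 (survives 1 (suc c))                    ≡⟨ cong (𝟙 ∘ not) (even?-alternating c) ⟩
      𝟙 (not (not (even? c)))                   ≡⟨ cong 𝟙 (trans (not-involutive (even? c)) (proj₁ (∧≡true⁻ Q≡true))) ⟩
      1                                         ∎))
      where open ≡-Reasoning

  local-bound : N + r / (2 * p′) + 𝟙 E + sumBelow G t ≤ ceilDiv r p′ + Z
  local-bound = +-cancelʳ-≤ ΣY _ _ (begin
    N + fl + 𝟙 E + ΣG + ΣY                ≡⟨ rearrange N fl (𝟙 E) ΣG ΣY ⟩
    N + (ΣG + ΣY) + fl + 𝟙 E              ≤⟨ +-monoˡ-≤ (𝟙 E) (+-monoˡ-≤ fl (+-monoʳ-≤ N ΣG+ΣY≤ΣT)) ⟩
    N + sumBelow T t + fl + 𝟙 E           ≡⟨ cong (λ x → x + fl + 𝟙 E) (odd-multiples-split t c r) ⟩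
    O + fl + 𝟙 E                          ≤⟨ odd-multiples-bound ⟩
    ceilDiv r p′ + 𝟙 W                    ≤⟨ +-monoʳ-≤ (ceilDiv r p′) endpoint-correction ⟩
    ceilDiv r p′ + (Z + ΣY)               ≡⟨ +-assoc (ceilDiv r p′) Z ΣY ⟨
    ceilDiv r p′ + Z + ΣY                 ∎)
    where
    open ≤-Reasoning
    instance _ = p-nonZero (2 + t)
    fl = r / (2 * p′)
    O = count (λ x → p′ ∣ᵇ x ∧ survives 1 x) c r
    ΣG = sumBelow G t
    ΣY = sumBelow Y t
    ΣG+ΣY≤ΣT : ΣG + ΣY ≤ sumBelow T t
    ΣG+ΣY≤ΣT = ≤-trans (≤-reflexive (sym (sumBelow-distrib-+ G Y t))) (sumBelow-mono-≤ t pair-multiples-bound)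
    rearrange : ∀ n f e g y → n + f + e + g + y ≡ n + (g + y) + f + e
    rearrange = solve-∀

-- Induction on the number of primes

sumRange-triangle-init : ∀ (g : ℕ → ℕ → ℕ) n →
  sumBelow (λ y → sumRange (3 + y) (suc n) (g (2 + y))) n ≡ sumRange 2 n (λ i → sumRange (suc i) (suc n) (g i))
sumRange-triangle-init g zero    = refl
sumRange-triangle-init g (suc n) = begin
  sumBelow h (suc n)                     ≡⟨ sumBelow-suc h n ⟩
  sumBelow h n + sumRange (3 + n) (2 + n) (g (2 + n)) ≡⟨ cong (sumBelow h n +_) (sumRange-empty (2 + n) _) ⟩
  sumBelow h n + 0                       ≡⟨ +-identityʳ _ ⟩
  sumBelow h n                           ≡⟨ sumRange≡sumBelow 2 (suc n) _ ⟨
  sumRange 2 (suc n) (λ i → sumRange (suc i) (2 + n) (g i)) ∎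
  where
  open ≡-Reasoning
  h = λ y → sumRange (3 + y) (2 + n) (g (2 + y))

sumRange-triangle-suc : ∀ (g : ℕ → ℕ → ℕ) n →
  sumRange 2 (suc n) (λ i → sumRange (suc i) (2 + n) (g i))
  ≡ sumRange 2 n (λ i → sumRange (suc i) (suc n) (g i)) + sumBelow (λ y → g (2 + y) (2 + n)) n
sumRange-triangle-suc g n = begin
  sumRange 2 (suc n) (λ i → sumRange (suc i) (2 + n) (g i))
    ≡⟨ sumRange≡sumBelow 2 (suc n) _ ⟩
  sumBelow (λ y → sumRange (3 + y) (2 + n) (g (2 + y))) n
    ≡⟨ sumBelow-cong n (λ y y<n → sumRange-suc (3 + y) (suc n) (g (2 + y)) (s≤s (s≤s y<n))) ⟩
  sumBelow (λ y → sumRange (3 + y) (suc n) (g (2 + y)) + g (2 + y) (2 + n)) n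
    ≡⟨ sumBelow-distrib-+ _ _ n ⟩
  sumBelow (λ y → sumRange (3 + y) (suc n) (g (2 + y))) n + sumBelow (λ y → g (2 + y) (2 + n)) n
    ≡⟨ cong (_+ sumBelow (λ y → g (2 + y) (2 + n)) n) (sumRange-triangle-init g n) ⟩
  sumRange 2 n (λ i → sumRange (suc i) (suc n) (g i)) + sumBelow (λ y → g (2 + y) (2 + n)) n
    ∎
  where open ≡-Reasoning

module Sieving {fmin : ℕ → ℕ → ℕ} (isMin : PhiMinimum fmin) (r c : ℕ) where

  G : ℕ → ℕ → ℕ
  G i j = fmin (_/_ r (p i * p j) {{m*n≢0 (p i) (p j) {{p-nonZero i}} {{p-nonZero j}}}}) (i ∸ 1)

  S₁ S₂ S₃ B : ℕ → ℕ
  S₁ j = sumRange 1 j (λ i → ceilDiv r (p i) {{p-nonZero i}})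
  S₂ j = sumRange 2 j (λ i → _/_ r (2 * p i) {{m*n≢0 2 (p i) {{_}} {{p-nonZero i}}}})
  S₃ j = sumRange 2 (j ∸ 1) (λ i → sumRange (suc i) j (G i))
  -- The slack of the base case when c is even and r odd, kept while c + 1 survives;
  -- it pays for the endpoint correction once c + 1 is sieved out.
  B j = 𝟙 ((even? c ∧ survives 1 r) ∧ survives j (suc c))

  Invariant : ℕ → Set
  Invariant j = r + S₂ j + Ecount j r + S₃ j + B j ≤ count (survives j) c r + S₁ j

  evens+B₁≤ : count even? c r + B 1 ≤ (r + 1) / 2
  evens+B₁≤ with even-or-odd r
  ... | inj₁ (r≡ , r-even) = ≤-reflexive (begin
    count even? c r + B 1            ≡⟨ cong₂ _+_ (cong (count even? c) r≡) B₁≡0 ⟩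
    count even? c (a * 2) + 0        ≡⟨ cong (_+ 0) (count-alternating-even even?-alternating c a) ⟩
    a + 0                            ≡⟨ +-identityʳ a ⟩
    a                                ≡⟨ [a*2+1]/2≡a ⟨
    (a * 2 + 1) / 2                  ≡⟨ cong (λ x → (x + 1) / 2) r≡ ⟨
    (r + 1) / 2                      ∎)
    where
    open ≡-Reasoning
    a = r / 2
    [a*2+1]/2≡a : (a * 2 + 1) / 2 ≡ a
    [a*2+1]/2≡a = trans (+-distrib-/-∣ˡ 1 (n∣m*n a)) (trans (cong (_+ 0) (m*n/n≡m a 2)) (+-identityʳ a))
    B₁≡0 : B 1 ≡ 0
    B₁≡0 = trans (cong (λ e → 𝟙 ((even? c ∧ not e) ∧ survives 1 (suc c))) r-even)
                 (cong (λ b → 𝟙 (b ∧ survives 1 (suc c))) (∧-zeroʳ (even? c)))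
  ... | inj₂ (r≡ , r-odd) = begin
    count even? c r + B 1                                   ≡⟨ cong (λ x → count even? c x + B 1) r≡ ⟩
    count even? c (1 + a * 2) + B 1                         ≡⟨ cong (_+ B 1) (count-alternating-odd even?-alternating c a) ⟩
    a + 𝟙 (even? (suc c)) + B 1                             ≤⟨ +-monoʳ-≤ (a + 𝟙 (even? (suc c))) (𝟙-mono {(even? c ∧ survives 1 r) ∧ survives 1 (suc c)} (λ h → proj₁ (∧≡true⁻ (proj₁ (∧≡true⁻ h))))) ⟩
    a + 𝟙 (even? (suc c)) + 𝟙 (even? c)                     ≡⟨ +-assoc a _ _ ⟩
    a + (𝟙 (even? (suc c)) + 𝟙 (even? c))                   ≡⟨ cong (λ e → a + (𝟙 e + 𝟙 (even? c))) (even?-alternating c) ⟩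
    a + (𝟙 (not (even? c)) + 𝟙 (even? c))                   ≡⟨ cong (a +_) (trans (+-comm (𝟙 (not (even? c))) _) (𝟙-not (even? c))) ⟩
    a + 1                                                   ≡⟨ +-comm a 1 ⟩
    suc a                                                   ≡⟨ m*n/n≡m (suc a) 2 ⟨
    (1 + (1 + a * 2)) / 2                                   ≡⟨ cong (_/ 2) (+-comm 1 (1 + a * 2)) ⟩
    (1 + a * 2 + 1) / 2                                     ≡⟨ cong (λ x → (x + 1) / 2) r≡ ⟨
    (r + 1) / 2                                             ∎
    where
    open ≤-Reasoning
    a = r / 2

  evens+odds : count even? c r + count (survives 1) c r ≡ r
  evens+odds = begin
    count even? c r + count (survives 1) c r   ≡⟨ sumOver-distrib-+ _ _ c r ⟨
    sumOver (λ x → 𝟙 (even? x) + 𝟙 (not (even? x))) c r ≡⟨ sumOver-cong (λ x → 𝟙-not (even? x)) c r ⟩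
    sumOver (λ _ → 1) c r                      ≡⟨ sumOver-const 1 c r ⟩
    r * 1                                      ≡⟨ *-identityʳ r ⟩
    r                                          ∎
    where open ≡-Reasoning

  invariant-1 : Invariant 1
  invariant-1 = begin
    r + 0 + 0 + 0 + B 1                                    ≡⟨ cong (_+ B 1) (trans (+-identityʳ _) (trans (+-identityʳ _) (+-identityʳ r))) ⟩
    r + B 1                                                ≡⟨ cong (_+ B 1) evens+odds ⟨
    count even? c r + count (survives 1) c r + B 1         ≡⟨ trans (cong (_+ B 1) (+-comm (count even? c r) _)) (+-assoc (count (survives 1) c r) _ (B 1)) ⟩
    count (survives 1) c r + (count even? c r + B 1)       ≤⟨ +-monoʳ-≤ _ evens+B₁≤ ⟩
    count (survives 1) c r + (r + 1) / 2                   ≡⟨ cong (count (survives 1) c r +_) (+-identityʳ _) ⟨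
    count (survives 1) c r + ((r + 1) / 2 + 0)             ∎
    where open ≤-Reasoning

  invariant-suc : ∀ t → Invariant (suc t) → Invariant (2 + t)
  invariant-suc t ih = begin
    r + S₂ (2 + t) + Ecount (2 + t) r + S₃ (2 + t) + B (2 + t)
      ≡⟨ cong (_+ B (2 + t)) (cong₂ _+_ (cong₂ _+_ (cong (r +_) split-S₂) split-E) split-S₃) ⟩
    r + (S₂ (1 + t) + fl) + (Ecount (1 + t) r + 𝟙 E) + (S₃ (1 + t) + sumBelow Gₜ t) + B (2 + t)
      ≤⟨ add-bounds r (S₂ (1 + t)) (Ecount (1 + t) r) (S₃ (1 + t)) (B (2 + t)) Z N (count (survives (2 + t)) c r)
                    (S₁ (1 + t)) fl (𝟙 E) (sumBelow Gₜ t) (ceilDiv r p′) ih′ local-bound ⟩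
    count (survives (2 + t)) c r + (S₁ (1 + t) + ceilDiv r p′)
      ≡⟨ cong (count (survives (2 + t)) c r +_) split-S₁ ⟨
    count (survives (2 + t)) c r + S₁ (2 + t)
      ∎
    where
    open ≤-Reasoning
    open OddMultiples t c r using (p′; E)
    open SieveStep isMin t c r using (N; Z; local-bound) renaming (G to Gₜ)
    instance _ = p-nonZero (2 + t)
    fl = r / (2 * p′)

    split-S₁ : S₁ (2 + t) ≡ S₁ (1 + t) + ceilDiv r p′
    split-S₁ = sumRange-suc 1 (suc t) (λ i → ceilDiv r (p i) {{p-nonZero i}}) (s≤s z≤n)
    split-S₂ : S₂ (2 + t) ≡ S₂ (1 + t) + fl
    split-S₂ = sumRange-suc 2 (suc t) (λ i → _/_ r (2 * p i) {{m*n≢0 2 (p i) {{_}} {{p-nonZero i}}}}) (s≤s (s≤s z≤n))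
    split-E : Ecount (2 + t) r ≡ Ecount (1 + t) r + 𝟙 E
    split-E = trans (Ecount≡sumBelow (2 + t) r) (trans (sumBelow-suc _ t) (cong (_+ 𝟙 E) (sym (Ecount≡sumBelow (1 + t) r))))
    split-S₃ : S₃ (2 + t) ≡ S₃ (1 + t) + sumBelow Gₜ t
    split-S₃ = sumRange-triangle-suc G t
    split-count : count (survives (1 + t)) c r ≡ count (survives (2 + t)) c r + N
    split-count = trans (sumOver-cong (λ x → 𝟙-split (survives (1 + t) x) (p′ ∣ᵇ x)) c r)
                        (sumOver-distrib-+ (𝟙 ∘ survives (2 + t)) (λ x → 𝟙 (survives (1 + t) x ∧ p′ ∣ᵇ x)) c r)
    split-B : B (1 + t) ≡ B (2 + t) + Z
    split-B = split (even? c ∧ survives 1 r) (survives (1 + t) (suc c)) (p′ ∣ᵇ suc c)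
      where
      split : ∀ q a d → 𝟙 (q ∧ a) ≡ 𝟙 (q ∧ (a ∧ not d)) + 𝟙 (q ∧ (a ∧ d))
      split false _ _ = refl
      split true  a d = 𝟙-split a d
    ih′ : r + S₂ (1 + t) + Ecount (1 + t) r + S₃ (1 + t) + (B (2 + t) + Z) ≤ count (survives (2 + t)) c r + N + S₁ (1 + t)
    ih′ = subst₂ _≤_ (cong (r + S₂ (1 + t) + Ecount (1 + t) r + S₃ (1 + t) +_) split-B) (cong (_+ S₁ (1 + t)) split-count) ih

    add-bounds : ∀ r s₂ e s₃ b z n k s₁ f ε g ce →
                 r + s₂ + e + s₃ + (b + z) ≤ k + n + s₁ → n + f + ε + g ≤ ce + z →
                 r + (s₂ + f) + (e + ε) + (s₃ + g) + b ≤ k + (s₁ + ce)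
    add-bounds r s₂ e s₃ b z n k s₁ f ε g ce h₁ h₂ = +-cancelʳ-≤ (z + n) _ _ (begin
      r + (s₂ + f) + (e + ε) + (s₃ + g) + b + (z + n)        ≡⟨ lhs≡ r s₂ e s₃ b z n f ε g ⟩
      (r + s₂ + e + s₃ + (b + z)) + (n + f + ε + g)          ≤⟨ +-mono-≤ h₁ h₂ ⟩
      (k + n + s₁) + (ce + z)                                ≡⟨ rhs≡ k n s₁ ce z ⟩
      k + (s₁ + ce) + (z + n)                                ∎)
      where
      lhs≡ : ∀ r s₂ e s₃ b z n f ε g →
             r + (s₂ + f) + (e + ε) + (s₃ + g) + b + (z + n) ≡ (r + s₂ + e + s₃ + (b + z)) + (n + f + ε + g)
      lhs≡ = solve-∀
      rhs≡ : ∀ k n s₁ ce z → (k + n + s₁) + (ce + z) ≡ k + (s₁ + ce) + (z + n)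
      rhs≡ = solve-∀

  invariant : ∀ j → 1 ≤ j → Invariant j
  invariant (suc zero)    _ = invariant-1
  invariant (suc (suc t)) _ = invariant-suc t (invariant (suc t) (s≤s z≤n))

-- Reduction to a window of length m mod Pₖ

1+a≤M : ∀ t a → suc a ≤ suc a * P t
1+a≤M t a = m≤m*n (suc a) (P t) {{P-nonZero t}}

survives-∣-[1+a]+j∣ : ∀ t a j → survives t ∣ -[1+ a ] ℤ.+ ℤ.+ j ∣ ≡ survives t (suc a * P t ∸ suc a + j)
survives-∣-[1+a]+j∣ t a j with suc a ≤? j
... | yes 1+a≤j = begin
  survives t ∣ -[1+ a ] ℤ.+ ℤ.+ j ∣     ≡⟨ cong (λ z → survives t ∣ z ∣) (ℤ.⊖-≥ 1+a≤j) ⟩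
  survives t (j ∸ suc a)                ≡⟨ survives-periodic t (j ∸ suc a) (n∣m*n (suc a)) ⟨
  survives t (M + (j ∸ suc a))          ≡⟨ cong (survives t) shift≡ ⟨
  survives t (M ∸ suc a + j)            ∎
  where
  open ≡-Reasoning
  M = suc a * P t
  shift≡ : M ∸ suc a + j ≡ M + (j ∸ suc a)
  shift≡ = begin
    M ∸ suc a + j                 ≡⟨ cong (M ∸ suc a +_) (m+[n∸m]≡n 1+a≤j) ⟨
    M ∸ suc a + (suc a + (j ∸ suc a)) ≡⟨ +-assoc (M ∸ suc a) (suc a) _ ⟨
    M ∸ suc a + suc a + (j ∸ suc a)   ≡⟨ cong (_+ (j ∸ suc a)) (m∸n+n≡m (1+a≤M t a)) ⟩
    M + (j ∸ suc a)               ∎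
... | no 1+a≰j = begin
  survives t ∣ -[1+ a ] ℤ.+ ℤ.+ j ∣     ≡⟨ cong (λ z → survives t ∣ z ∣) (ℤ.⊖-< j<1+a) ⟩
  survives t ∣ ℤ.- ℤ.+ (suc a ∸ j) ∣    ≡⟨ cong (survives t) (ℤ.∣-i∣≡∣i∣ (ℤ.+ (suc a ∸ j))) ⟩
  survives t (suc a ∸ j)                ≡⟨ survives-complement t _ _ (n∣m*n (suc a)) complement≡ ⟨
  survives t (M ∸ suc a + j)            ∎
  where
  open ≡-Reasoning
  M = suc a * P t
  j<1+a = ≰⇒> 1+a≰j
  complement≡ : M ∸ suc a + j + (suc a ∸ j) ≡ M
  complement≡ = begin
    M ∸ suc a + j + (suc a ∸ j)   ≡⟨ +-assoc (M ∸ suc a) j _ ⟩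
    M ∸ suc a + (j + (suc a ∸ j)) ≡⟨ cong (M ∸ suc a +_) (m+[n∸m]≡n (<⇒≤ j<1+a)) ⟩
    M ∸ suc a + suc a             ≡⟨ m∸n+n≡m (1+a≤M t a) ⟩
    M                             ∎

phiInt≡count-shift : ∀ b n t → ∃[ y ] phiInt b n t ≡ count (survives t) y n
phiInt≡count-shift (ℤ.+ y)    n t = y , phiInt≡count y n t
phiInt≡count-shift -[1+ a ] n t = suc a * P t ∸ suc a , (begin
  phiInt -[1+ a ] n t                                                 ≡⟨ length-filter-upTo _ suc id n ⟩
  sumBelow (λ x → 𝟙 (does (gcd ∣ -[1+ a ] ℤ.+ ℤ.+ suc x ∣ (P t) ≟ 1))) n ≡⟨ sumBelow-cong n (λ x _ → cong 𝟙 (surv x)) ⟩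
  sumBelow (λ x → 𝟙 (survives t (suc a * P t ∸ suc a + suc x))) n      ≡⟨ sumBelow-sumOver _ _ n ⟩
  count (survives t) (suc a * P t ∸ suc a) n                          ∎)
  where
  open ≡-Reasoning
  surv : ∀ x → does (gcd ∣ -[1+ a ] ℤ.+ ℤ.+ suc x ∣ (P t) ≟ 1) ≡ survives t (suc a * P t ∸ suc a + suc x)
  surv x = trans (gcd≟1≡survives t _) (survives-∣-[1+a]+j∣ t a (suc x))

count-periods : ∀ t y m → count (survives t) y m
                ≡ totient (P t) * _/_ m (P t) {{P-nonZero t}} + count (survives t) y (_%_ m (P t) {{P-nonZero t}})
count-periods t y m = begin
  count (survives t) y m                             ≡⟨ cong (count (survives t) y) (m≡m%n+[m/n]*n m (P t)) ⟩
  count (survives t) y (r + q * P t)                 ≡⟨ sumOver-+ _ y r (q * P t) ⟩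
  count (survives t) y r + count (survives t) (y + r) (q * P t)
                                                     ≡⟨ cong (count (survives t) y r +_) (sumOver-periodic _ (P t) periodic q (y + r)) ⟩
  count (survives t) y r + q * count (survives t) 0 (P t)
                                                     ≡⟨ cong (λ x → count (survives t) y r + q * x) (totient≡count t) ⟨
  count (survives t) y r + q * totient (P t)         ≡⟨ +-comm _ (q * totient (P t)) ⟩
  q * totient (P t) + count (survives t) y r         ≡⟨ cong (_+ count (survives t) y r) (*-comm q _) ⟩
  totient (P t) * q + count (survives t) y r         ∎
  where
  open ≡-Reasoning
  instance _ = P-nonZero t
  q = m / P t
  r = m % P t
  periodic : ∀ x → 𝟙 (survives t (P t + x)) ≡ 𝟙 (survives t x)
  periodic x = cong 𝟙 (survives-periodic t x ∣-refl)

ℤ-bound : ∀ a r s₁ s₂ e s₃ k → r + s₂ + e + s₃ ≤ k + s₁ →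
          ℤ.+ a ℤ.+ ℤ.+ r ℤ.- ℤ.+ s₁ ℤ.+ ℤ.+ s₂ ℤ.+ ℤ.+ e ℤ.+ ℤ.+ s₃ ℤ.≤ ℤ.+ (a + k)
ℤ-bound a r s₁ s₂ e s₃ k h = begin
  ℤ.+ a ℤ.+ ℤ.+ r ℤ.- ℤ.+ s₁ ℤ.+ ℤ.+ s₂ ℤ.+ ℤ.+ e ℤ.+ ℤ.+ s₃ ≡⟨ move-s₁ (ℤ.+ a) (ℤ.+ r) (ℤ.+ s₁) (ℤ.+ s₂) (ℤ.+ e) (ℤ.+ s₃) ⟩
  ℤ.+ (a + (r + s₂ + e + s₃)) ℤ.- ℤ.+ s₁                     ≤⟨ ℤ.+-monoˡ-≤ (ℤ.- ℤ.+ s₁) (ℤ.+≤+ (+-monoʳ-≤ a h)) ⟩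
  ℤ.+ (a + (k + s₁)) ℤ.- ℤ.+ s₁                              ≡⟨ cancel-s₁ (ℤ.+ a) (ℤ.+ k) (ℤ.+ s₁) ⟩
  ℤ.+ (a + k)                                                ∎
  where
  open ℤ.≤-Reasoning
  move-s₁ : ∀ A R S₁ S₂ E S₃ → A ℤ.+ R ℤ.- S₁ ℤ.+ S₂ ℤ.+ E ℤ.+ S₃ ≡ A ℤ.+ (R ℤ.+ S₂ ℤ.+ E ℤ.+ S₃) ℤ.- S₁
  move-s₁ = ℤ.solve-∀
  cancel-s₁ : ∀ A K S₁ → A ℤ.+ (K ℤ.+ S₁) ℤ.- S₁ ≡ A ℤ.+ K
  cancel-s₁ = ℤ.solve-∀

open import Data.Integer using (+_) renaming (_≤_ to _≤ℤ_)

theorem4p4 : (fmin : ℕ → ℕ → ℕ) → ((n t : ℕ) → 1 ≤ t → IsPhiMin n t (fmin n t))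
    → (k m : ℕ) → 1 ≤ k → lhs fmin k m ≤ℤ + fmin m k
theorem4p4 fmin isMin k m 1≤k = subst (lhs fmin k m ≤ℤ_) (cong +_ φ-min≡)
  (ℤ-bound (totient (P k) * (m / P k)) r (S₁ k) (S₂ k) (Ecount k r) (S₃ k) (count (survives k) y r)
    (≤-trans (m≤m+n _ (B k)) (invariant k 1≤k)))
  where
  instance _ = P-nonZero k
  r = m % P k
  minimiser = proj₁ (isMin m k 1≤k)
  b = proj₁ minimiser
  shift = phiInt≡count-shift b m k
  y = proj₁ shift
  open Sieving isMin r y
  open ≡-Reasoning
  φ-min≡ : totient (P k) * (m / P k) + count (survives k) y r ≡ fmin m k
  φ-min≡ = begin
    totient (P k) * (m / P k) + count (survives k) y r ≡⟨ count-periods k y m ⟨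
    count (survives k) y m                             ≡⟨ proj₂ shift ⟨
    phiInt b m k                                       ≡⟨ proj₂ minimiser ⟩
    fmin m k                                           ∎
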